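{- Let $n\ge 2$, let $p$ be chosen uniformly at random from $S_n$, and let $m(p)=|D_1(p)|$ be the number of distinct $(n-1)$-patterns of $p$. Then $$\mathbb{E}(m) = n-2\frac{n-1}{n}\quad\text{and}\quad \mathrm{Var}(m) = 4\frac{(n-2)^2}{n(n-1)} + 2\frac{n-1}{n} - 4\frac{(n-1)^2}{n^2}.$$
   Context: For $p\in S_n$ (one-line notation), $D_1(p)$ is the set of permutations in $S_{n-1}$ obtainable from $p$ by deleting one entry and relabelling the remaining entries $1$ through $n-1$ preserving relative order. -}

module Defs where

open import Data.Nat using (ℕ; zero; suc; _<?_; _!)
import Data.Nat as ℕ
open import Data.Nat.ListAction using (sum)
open import Data.Nat.Properties using (_!≢0)
import Data.Nat.Properties as ℕP
open import Data.Integer using (+_)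
open import Data.List using (List; []; _∷_; map; length; filter; deduplicate; upTo; concatMap)
open import Data.List.Properties using (≡-dec)
open import Data.List.Relation.Unary.Unique.DecPropositional ℕP._≟_ using (unique?)
open import Data.Rational using (ℚ; _/_; _-_) renaming (0ℚ to zeroℚ)
import Data.Rational as ℚ

-- One-line notation over the alphabet {0,…,n-1} (0-based instead of 1-based).

words : ℕ → ℕ → List (List ℕ)
words n zero = [] ∷ []
words n (suc k) = concatMap (λ x → map (x ∷_) (words n k)) (upTo n)

S : ℕ → List (List ℕ)
S n = filter unique? (words n n)

deleteAt : ℕ → List ℕ → List ℕ
deleteAt i [] = []
deleteAt zero (x ∷ xs) = xs
deleteAt (suc i) (x ∷ xs) = x ∷ deleteAt i xs

standardize : List ℕ → List ℕ
standardize q = map (λ x → length (filter (_<? x) q)) q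

D₁ : List ℕ → List (List ℕ)
D₁ p = deduplicate (≡-dec ℕP._≟_) (map (λ i → standardize (deleteAt i p)) (upTo (length p)))

m : List ℕ → ℕ
m p = length (D₁ p)

-- a / d as a rational (only used with d ≠ 0)
frac : ℕ → ℕ → ℚ
frac a zero = zeroℚ
frac a (suc d) = (+ a) / suc d

E : ℕ → ℚ
E n = ((+ sum (map m (S n))) / (n !)) {{n !≢0}}

Var : ℕ → ℚ
Var n = ((+ sum (map (λ p → m p ℕ.* m p) (S n))) / (n !)) {{n !≢0}} - E n ℚ.* E n

-- A bond of p is a pair of adjacent entries with consecutive values. Deleting entry i or
-- entry i + 1 gives the same pattern exactly when these two entries form a bond, and two
-- deletions give the same pattern only inside a run of bonds; hence m(p) = n − bonds(p).
-- The first two moments of the number of bonds over S n follow from recurrences obtained by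
-- inserting the maximum n at each of the n + 1 positions of every p ∈ S n: the insertion
-- breaks the bond it lands in (if any) and forms a bond with each neighbour equal to n − 1,
-- a value that occurs exactly once in p. Solving the recurrences gives the sums over S (k + 2)
-- as multiples of k!, and the formulas for E and Var follow by arithmetic in ℚ.

module Submission where

open import Defs
open import Data.Nat using (ℕ; zero; suc; _∸_; _^_; _!; _≤_; _<_; z≤n; s≤s; _<?_; _≟_; NonZero)
import Data.Nat as ℕ
open import Data.Nat.Properties
open import Function using (_∘_; _∘′_)
open import Data.Nat.ListAction using (sum)
open import Data.Nat.ListAction.Properties using (sum-++; sum-↭)
open import Data.Nat.Tactic.RingSolver using (solve-∀)
open import Algebra.Properties.CommutativeSemigroup +-commutativeSemigroup using (interchange)
open import Data.List using (List; []; _∷_; map; length; filter; deduplicate; upTo; applyUpTo; concatMap; _++_)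
open import Data.List.Properties
  using (≡-dec; ∷-injectiveˡ; ∷-injectiveʳ; length-++; length-upTo; map-++; map-cong-local; map-applyUpTo;
         applyUpTo-∷ʳ; filter-accept; filter-reject; filter-all)
open import Data.List.Relation.Unary.All using (All; []; _∷_)
import Data.List.Relation.Unary.All as All
open import Data.List.Relation.Unary.Any using (here; there)
import Data.List.Relation.Unary.Any as Any
open import Data.List.Relation.Unary.AllPairs using ([]; _∷_)
open import Data.List.Relation.Unary.Unique.Propositional using (Unique)
import Data.List.Relation.Unary.Unique.Propositional.Properties as Unique
open import Data.List.Relation.Unary.Unique.DecPropositional _≟_ using (unique?)
open import Data.List.Membership.Propositional using (_∈_; _∉_; find)
open import Data.List.Membership.Propositional.Properties
open import Data.List.Membership.DecPropositional _≟_ using (_∈?_)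
open import Data.List.Membership.Propositional.Properties.WithK using (unique∧set⇒bag)
open import Data.List.Relation.Binary.BagAndSetEquality using (∼bag⇒↭)
open import Data.List.Relation.Binary.Permutation.Propositional using (_↭_)
import Data.List.Relation.Binary.Permutation.Propositional.Properties as Perm
open import Function.Bundles using (mk⇔)
open import Data.Product using (∃-syntax; _×_; _,_; proj₂)
open import Data.Sum using (_⊎_; inj₁; inj₂; map₂; swap)
open import Data.Empty using (⊥-elim)
open import Relation.Nullary using (¬_; Dec; yes; no)
open import Relation.Nullary.Decidable using (_⊎-dec_; ¬?)
open import Relation.Nullary.Negation using (contradiction)
open import Relation.Binary.Definitions using (DecidableEquality)
open import Relation.Binary.PropositionalEquality

-- ℕ's _+_ and _*_ are opened only inside this module; at top level they are ℚ's, as in the statement.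
module Counting where
  open import Data.Nat using (_+_; _*_)

  𝟙 : {P : Set} → Dec P → ℕ
  𝟙 (yes _) = 1
  𝟙 (no _)  = 0

  𝟙-yes : {P : Set} (d : Dec P) → P → 𝟙 d ≡ 1
  𝟙-yes (yes _) _  = refl
  𝟙-yes (no ¬p) p = contradiction p ¬p

  𝟙-no : {P : Set} (d : Dec P) → ¬ P → 𝟙 d ≡ 0
  𝟙-no (yes p) ¬p = contradiction p ¬p
  𝟙-no (no _)  _  = refl

  𝟙-cong : {P Q : Set} (d : Dec P) (e : Dec Q) → (P → Q) → (Q → P) → 𝟙 d ≡ 𝟙 e
  𝟙-cong (yes p) e to _    = sym (𝟙-yes e (to p))
  𝟙-cong (no ¬p) e _  from = sym (𝟙-no e (¬p ∘ from))

  𝟙-idem : {P : Set} (d : Dec P) → 𝟙 d * 𝟙 d ≡ 𝟙 d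
  𝟙-idem (yes _) = refl
  𝟙-idem (no _)  = refl

  𝟙*𝟙 : {P Q : Set} (d : Dec P) (e : Dec Q) → ¬ (P × Q) → 𝟙 d * 𝟙 e ≡ 0
  𝟙*𝟙 (yes p) (yes q) ¬pq = contradiction (p , q) ¬pq
  𝟙*𝟙 (yes _) (no _)  _   = refl
  𝟙*𝟙 (no _)  _       _   = refl

  sumMap : {A : Set} → (A → ℕ) → List A → ℕ
  sumMap f xs = sum (map f xs)

  sumTo : (ℕ → ℕ) → ℕ → ℕ
  sumTo f n = sum (applyUpTo f n)

  module _ {A : Set} where

    sumMap-cong : ∀ {f g : A → ℕ} xs → (∀ {x} → x ∈ xs → f x ≡ g x) → sumMap f xs ≡ sumMap g xs
    sumMap-cong xs f≗g = cong sum (map-cong-local (All.tabulate f≗g))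

    sumMap-+ : ∀ (f g : A → ℕ) xs → sumMap (λ x → f x + g x) xs ≡ sumMap f xs + sumMap g xs
    sumMap-+ f g []       = refl
    sumMap-+ f g (x ∷ xs) = trans (cong (f x + g x +_) (sumMap-+ f g xs)) (interchange (f x) (g x) _ _)

    sumMap-* : ∀ k (f : A → ℕ) xs → sumMap (λ x → k * f x) xs ≡ k * sumMap f xs
    sumMap-* k f []       = sym (*-zeroʳ k)
    sumMap-* k f (x ∷ xs) = trans (cong (k * f x +_) (sumMap-* k f xs)) (sym (*-distribˡ-+ k (f x) _))

    sumMap-const : ∀ k (xs : List A) → sumMap (λ _ → k) xs ≡ length xs * k
    sumMap-const k []       = refl
    sumMap-const k (x ∷ xs) = cong (k +_) (sumMap-const k xs)

    sumMap-*-* : ∀ k l (f : A → ℕ) xs → sumMap (λ x → k * (l * f x)) xs ≡ k * (l * sumMap f xs)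
    sumMap-*-* k l f xs = trans (sumMap-* k (λ x → l * f x) xs) (cong (k *_) (sumMap-* l f xs))

    sumMap-+₃ : ∀ (f g h : A → ℕ) xs →
                sumMap (λ x → f x + g x + h x) xs ≡ sumMap f xs + sumMap g xs + sumMap h xs
    sumMap-+₃ f g h xs = trans (sumMap-+ (λ x → f x + g x) h xs) (cong (_+ sumMap h xs) (sumMap-+ f g xs))

    sumMap-applyUpTo : ∀ (f : A → ℕ) (h : ℕ → A) n → sumMap f (applyUpTo h n) ≡ sumTo (f ∘ h) n
    sumMap-applyUpTo f h n = cong sum (map-applyUpTo h f n)

    sumMap-concatMap : ∀ {B : Set} (f : B → ℕ) (g : A → List B) xs →
                       sumMap f (concatMap g xs) ≡ sumMap (sumMap f ∘ g) xs
    sumMap-concatMap f g []       = refl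
    sumMap-concatMap f g (x ∷ xs) = begin
      sum (map f (g x ++ concatMap g xs))                 ≡⟨ cong sum (map-++ f (g x) _) ⟩
      sum (map f (g x) ++ map f (concatMap g xs))         ≡⟨ sum-++ (map f (g x)) _ ⟩
      sumMap f (g x) + sumMap f (concatMap g xs)          ≡⟨ cong (sumMap f (g x) +_) (sumMap-concatMap f g xs) ⟩
      sumMap f (g x) + sumMap (sumMap f ∘ g) xs           ∎
      where open ≡-Reasoning

  sumTo-as-sumMap : ∀ f n → sumTo f n ≡ sumMap f (upTo n)
  sumTo-as-sumMap f n = sym (sumMap-applyUpTo f (λ i → i) n)

  sumTo-cong : ∀ {f g} n → (∀ {i} → i < n → f i ≡ g i) → sumTo f n ≡ sumTo g n
  sumTo-cong {f} {g} n f≗g = begin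
    sumTo f n          ≡⟨ sumTo-as-sumMap f n ⟩
    sumMap f (upTo n)  ≡⟨ sumMap-cong (upTo n) (f≗g ∘ ∈-upTo⁻) ⟩
    sumMap g (upTo n)  ≡⟨ sumTo-as-sumMap g n ⟨
    sumTo g n          ∎
    where open ≡-Reasoning

  sumTo-+ : ∀ n (f g : ℕ → ℕ) → sumTo (λ i → f i + g i) n ≡ sumTo f n + sumTo g n
  sumTo-+ n f g = begin
    sumTo (λ i → f i + g i) n               ≡⟨ sumTo-as-sumMap _ n ⟩
    sumMap (λ i → f i + g i) (upTo n)       ≡⟨ sumMap-+ f g (upTo n) ⟩
    sumMap f (upTo n) + sumMap g (upTo n)   ≡⟨ cong₂ _+_ (sumTo-as-sumMap f n) (sumTo-as-sumMap g n) ⟨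
    sumTo f n + sumTo g n                   ∎
    where open ≡-Reasoning

  sumTo-* : ∀ n k (f : ℕ → ℕ) → sumTo (λ i → k * f i) n ≡ k * sumTo f n
  sumTo-* n k f = begin
    sumTo (λ i → k * f i) n          ≡⟨ sumTo-as-sumMap _ n ⟩
    sumMap (λ i → k * f i) (upTo n)  ≡⟨ sumMap-* k f (upTo n) ⟩
    k * sumMap f (upTo n)            ≡⟨ cong (k *_) (sumTo-as-sumMap f n) ⟨
    k * sumTo f n                    ∎
    where open ≡-Reasoning

  sumTo-const : ∀ n k → sumTo (λ _ → k) n ≡ n * k
  sumTo-const n k = begin
    sumTo (λ _ → k) n           ≡⟨ sumTo-as-sumMap _ n ⟩
    sumMap (λ _ → k) (upTo n)   ≡⟨ sumMap-const k (upTo n) ⟩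
    length (upTo n) * k         ≡⟨ cong (_* k) (length-upTo n) ⟩
    n * k                       ∎
    where open ≡-Reasoning

  sumTo-suc : ∀ n f → sumTo f (suc n) ≡ sumTo f n + f n
  sumTo-suc n f = begin
    sum (applyUpTo f (suc n))               ≡⟨ cong sum (applyUpTo-∷ʳ f n) ⟨
    sum (applyUpTo f n ++ f n ∷ [])         ≡⟨ sum-++ (applyUpTo f n) _ ⟩
    sumTo f n + (f n + 0)                   ≡⟨ cong (sumTo f n +_) (+-identityʳ (f n)) ⟩
    sumTo f n + f n                         ∎
    where open ≡-Reasoning

  sumTo-*-* : ∀ n k l f → sumTo (λ j → k * (l * f j)) n ≡ k * (l * sumTo f n)
  sumTo-*-* n k l f = trans (sumTo-* n k (λ j → l * f j)) (cong (k *_) (sumTo-* n l f))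

  Unique-concatMap : ∀ {A B : Set} (g : A → List B) {xs} → Unique xs →
    (∀ {x} → x ∈ xs → Unique (g x)) →
    (∀ {x y z} → x ∈ xs → y ∈ xs → z ∈ g x → z ∈ g y → x ≡ y) →
    Unique (concatMap g xs)
  Unique-concatMap g {[]} [] _ _ = []
  Unique-concatMap g {x ∷ xs} (x∉ ∷ u) ug disjoint =
    Unique.++⁺ (ug (here refl))
      (Unique-concatMap g u (ug ∘′ there) (λ x∈ y∈ → disjoint (there x∈) (there y∈)))
      apart
    where
    apart : ∀ {z} → ¬ (z ∈ g x × z ∈ concatMap g xs)
    apart (z∈x , z∈xs)
      with y , y∈ , z∈y ← find (∈-concatMap⁻ g {xs = xs} z∈xs)
      with refl ← disjoint (here refl) (there y∈) z∈x z∈y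
      = All.lookup x∉ y∈ refl

  length-mono-⊆ : ∀ {A : Set} {xs ys : List A} → Unique xs → (∀ {z} → z ∈ xs → z ∈ ys) →
                  length xs ≤ length ys
  length-mono-⊆ {xs = []} _ _ = z≤n
  length-mono-⊆ {xs = x ∷ xs} (x∉ ∷ u) xs⊆ys with as , bs , refl ← ∈-∃++ (xs⊆ys (here refl)) = begin
    suc (length xs)              ≤⟨ s≤s (length-mono-⊆ u xs⊆as++bs) ⟩
    suc (length (as ++ bs))      ≡⟨ cong suc (length-++ as) ⟩
    suc (length as + length bs)  ≡⟨ +-suc (length as) (length bs) ⟨
    length as + suc (length bs)  ≡⟨ length-++ as ⟨
    length (as ++ x ∷ bs)        ∎
    where
    open ≤-Reasoning
    xs⊆as++bs : ∀ {z} → z ∈ xs → z ∈ as ++ bs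
    xs⊆as++bs z∈ with ∈-++⁻ as (xs⊆ys (there z∈))
    ... | inj₁ z∈as         = ∈-++⁺ˡ z∈as
    ... | inj₂ (here refl)  = ⊥-elim (All.lookup x∉ z∈ refl)
    ... | inj₂ (there z∈bs) = ∈-++⁺ʳ as z∈bs

  ContiguousFibres : {A : Set} → (ℕ → A) → ℕ → Set
  ContiguousFibres f n = ∀ {i j} → i < j → j ≤ n → f i ≡ f j → f i ≡ f (suc i)

  module _ {A : Set} (_≟ᴬ_ : DecidableEquality A) where

    length-deduplicate-contiguous : ∀ n f → ContiguousFibres f n →
      length (deduplicate _≟ᴬ_ (applyUpTo f (suc n))) + sumTo (λ i → 𝟙 (f i ≟ᴬ f (suc i))) n ≡ suc n
    length-deduplicate-contiguous zero    f _          = refl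
    length-deduplicate-contiguous (suc n) f contiguous = begin
      suc (length (filter fresh? D)) + (𝟙 (f 0 ≟ᴬ f 1) + R)  ≡⟨ cong suc (+-assoc (length (filter fresh? D)) _ R) ⟨
      suc (length (filter fresh? D) + 𝟙 (f 0 ≟ᴬ f 1) + R)    ≡⟨ cong (λ t → suc (t + R)) (drop-head (f 0 ≟ᴬ f 1)) ⟩
      suc (length D + R)                                    ≡⟨ cong suc (length-deduplicate-contiguous n (f ∘ suc) contiguous-tail) ⟩
      suc (suc n)                                           ∎
      where
      open ≡-Reasoning
      fresh? = ¬? ∘ (f 0 ≟ᴬ_)
      D = deduplicate _≟ᴬ_ (applyUpTo (f ∘ suc) (suc n))
      R = sumTo (λ i → 𝟙 (f (suc i) ≟ᴬ f (suc (suc i)))) n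
      contiguous-tail : ContiguousFibres (f ∘ suc) n
      contiguous-tail i<j j≤n = contiguous (s≤s i<j) (s≤s j≤n)
      drop-head : (d : Dec (f 0 ≡ f 1)) → length (filter fresh? D) + 𝟙 d ≡ length D
      drop-head (yes f0≡f1) = begin
        length (filter fresh? (f 1 ∷ D′)) + 1  ≡⟨ cong (λ l → length l + 1) (filter-reject fresh? (λ f0≢f1 → f0≢f1 f0≡f1)) ⟩
        length (filter fresh? D′) + 1          ≡⟨ cong (λ l → length l + 1) (filter-all fresh? (All.tabulate differs)) ⟩
        length D′ + 1                          ≡⟨ +-comm (length D′) 1 ⟩
        suc (length D′)                        ∎
        where
        D′ = filter (¬? ∘ (f 1 ≟ᴬ_)) (deduplicate _≟ᴬ_ (applyUpTo (f ∘ suc ∘ suc) n))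
        differs : ∀ {z} → z ∈ D′ → ¬ f 0 ≡ z
        differs z∈ f0≡z = proj₂ (∈-filter⁻ (¬? ∘ (f 1 ≟ᴬ_)) {xs = deduplicate _≟ᴬ_ (applyUpTo (f ∘ suc ∘ suc) n)} z∈)
                                (trans (sym f0≡f1) f0≡z)
      drop-head (no f0≢f1) = trans (+-identityʳ _) (cong length (filter-all fresh? (All.tabulate absent)))
        where
        absent : ∀ {z} → z ∈ D → ¬ f 0 ≡ z
        absent z∈ f0≡z with i , i≤n , refl ← ∈-applyUpTo⁻ (f ∘ suc) (∈-deduplicate⁻ _≟ᴬ_ (applyUpTo (f ∘ suc) (suc n)) z∈)
          = f0≢f1 (contiguous (s≤s z≤n) i≤n f0≡z)

  ∈-words⁺ : ∀ n k {w} → length w ≡ k → All (_< n) w → w ∈ words n k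
  ∈-words⁺ n zero    {[]}    refl []         = here refl
  ∈-words⁺ n (suc k) {x ∷ w} refl (x<n ∷ w<n) =
    ∈-concatMap⁺ (λ y → map (y ∷_) (words n k))
      (Any.map (λ { refl → ∈-map⁺ (x ∷_) (∈-words⁺ n k refl w<n) }) (∈-upTo⁺ x<n))

  ∈-words⁻ : ∀ n k {w} → w ∈ words n k → length w ≡ k × All (_< n) w
  ∈-words⁻ n zero (here refl) = refl , []
  ∈-words⁻ n (suc k) w∈
    with _ , x∈ , w∈′ ← find (∈-concatMap⁻ (λ y → map (y ∷_) (words n k)) {xs = upTo n} w∈)
    with _ , ys∈ , refl ← map∷⁻ w∈′
    with refl , ys<n ← ∈-words⁻ n k ys∈
    = refl , ∈-upTo⁻ x∈ ∷ ys<n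

  record IsPermutation (n : ℕ) (p : List ℕ) : Set where
    constructor isPermutation
    field
      unique  : Unique p
      length≡ : length p ≡ n
      bounded : All (_< n) p
  open IsPermutation

  ∈-S⁺ : ∀ {n p} → IsPermutation n p → p ∈ S n
  ∈-S⁺ {n} (isPermutation u l b) = ∈-filter⁺ unique? (∈-words⁺ n n l b) u

  ∈-S⁻ : ∀ {n p} → p ∈ S n → IsPermutation n p
  ∈-S⁻ {n} p∈
    with w∈ , u ← ∈-filter⁻ unique? {xs = words n n} p∈
    with l , b ← ∈-words⁻ n n w∈
    = isPermutation u l b

  Unique-words : ∀ n k → Unique (words n k)
  Unique-words n zero    = [] ∷ []
  Unique-words n (suc k) =
    Unique-concatMap (λ y → map (y ∷_) (words n k)) (Unique.upTo⁺ n)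
      (λ _ → Unique.map⁺ (λ { refl → refl }) (Unique-words n k))
      (λ _ _ → same-head)
    where
    same-head : ∀ {x y z} → z ∈ map (x ∷_) (words n k) → z ∈ map (y ∷_) (words n k) → x ≡ y
    same-head z∈x z∈y with _ , _ , refl ← map∷⁻ z∈x with _ , _ , refl ← map∷⁻ z∈y = refl

  Unique-S : ∀ n → Unique (S n)
  Unique-S n = Unique.filter⁺ unique? (Unique-words n n)

  ∈-permutation : ∀ {n p v} → IsPermutation n p → v < n → v ∈ p
  ∈-permutation {n} {p} {v} (isPermutation u l b) v<n with v ∈? p
  ... | yes v∈p = v∈p
  ... | no  v∉p = contradiction (length-mono-⊆ (All.tabulate (λ { z∈ refl → v∉p z∈ }) ∷ u) ⊆upTo)
                    (λ sp≤n → 1+n≰n (subst₂ _≤_ (cong suc l) (length-upTo n) sp≤n))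
    where
    ⊆upTo : ∀ {z} → z ∈ v ∷ p → z ∈ upTo n
    ⊆upTo (here refl) = ∈-upTo⁺ v<n
    ⊆upTo (there z∈)  = ∈-upTo⁺ (All.lookup b z∈)

  count-below-permutation : ∀ {n p x} → IsPermutation n p → x ∈ p → length (filter (_<? x) p) ≡ x
  count-below-permutation {n} {p} {x} π x∈p = ≤-antisym
    (≤-trans (length-mono-⊆ (Unique.filter⁺ (_<? x) (unique π)) below⊆upTo) (≤-reflexive (length-upTo x)))
    (≤-trans (≤-reflexive (sym (length-upTo x))) (length-mono-⊆ (Unique.upTo⁺ x) upTo⊆below))
    where
    below⊆upTo : ∀ {z} → z ∈ filter (_<? x) p → z ∈ upTo x
    below⊆upTo z∈ = ∈-upTo⁺ (proj₂ (∈-filter⁻ (_<? x) {xs = p} z∈))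
    upTo⊆below : ∀ {z} → z ∈ upTo x → z ∈ filter (_<? x) p
    upTo⊆below z∈ = ∈-filter⁺ (_<? x)
      (∈-permutation π (<-trans (∈-upTo⁻ z∈) (All.lookup (bounded π) x∈p))) (∈-upTo⁻ z∈)

  -- Deletion patterns and bonds

  -- Positions past the end read as 0.
  entry : List ℕ → ℕ → ℕ
  entry []      _       = 0
  entry (x ∷ p) zero    = x
  entry (x ∷ p) (suc i) = entry p i

  entry-∈ : ∀ p {i} → i < length p → entry p i ∈ p
  entry-∈ (x ∷ p) {zero}  _         = here refl
  entry-∈ (x ∷ p) {suc i} (s≤s i<) = there (entry-∈ p i<)

  entry-map : ∀ f xs {i} → i < length xs → entry (map f xs) i ≡ f (entry xs i)
  entry-map f (x ∷ xs) {zero}  _         = refl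
  entry-map f (x ∷ xs) {suc i} (s≤s i<) = entry-map f xs i<

  entry-injective : ∀ p {i j} → Unique p → i < length p → j < length p → entry p i ≡ entry p j → i ≡ j
  entry-injective (x ∷ p) {zero}  {zero}  _        _         _         _ = refl
  entry-injective (x ∷ p) {zero}  {suc j} (x∉ ∷ _) _         (s≤s j<) eq = ⊥-elim (All.lookup x∉ (entry-∈ p j<) eq)
  entry-injective (x ∷ p) {suc i} {zero}  (x∉ ∷ _) (s≤s i<) _         eq = ⊥-elim (All.lookup x∉ (entry-∈ p i<) (sym eq))
  entry-injective (x ∷ p) {suc i} {suc j} (_ ∷ u)  (s≤s i<) (s≤s j<) eq = cong suc (entry-injective p u i< j< eq)

  entry-deleteAt-< : ∀ p {j k} → k < j → entry (deleteAt j p) k ≡ entry p k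
  entry-deleteAt-< []      _                      = refl
  entry-deleteAt-< (x ∷ p) {suc j} {zero}  _          = refl
  entry-deleteAt-< (x ∷ p) {suc j} {suc k} (s≤s k<j) = entry-deleteAt-< p k<j

  entry-deleteAt-≥ : ∀ p {j k} → j ≤ k → entry (deleteAt j p) k ≡ entry p (suc k)
  entry-deleteAt-≥ []      _                     = refl
  entry-deleteAt-≥ (x ∷ p) {zero}  _               = refl
  entry-deleteAt-≥ (x ∷ p) {suc j} {suc k} (s≤s j≤k) = entry-deleteAt-≥ p j≤k

  length-deleteAt : ∀ p {i} → i < length p → suc (length (deleteAt i p)) ≡ length p
  length-deleteAt (x ∷ p) {zero}  _         = refl
  length-deleteAt (x ∷ p) {suc i} (s≤s i<) = cong suc (length-deleteAt p i<)

  ∈-deleteAt⁻ : ∀ p {i x} → x ∈ deleteAt i p → x ∈ p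
  ∈-deleteAt⁻ (y ∷ p) {zero}  x∈          = there x∈
  ∈-deleteAt⁻ (y ∷ p) {suc i} (here refl) = here refl
  ∈-deleteAt⁻ (y ∷ p) {suc i} (there x∈)  = there (∈-deleteAt⁻ p x∈)

  count-below-deleteAt : ∀ x p {i} → i < length p →
    length (filter (_<? x) (deleteAt i p)) + 𝟙 (entry p i <? x) ≡ length (filter (_<? x) p)
  count-below-deleteAt x (y ∷ p) {zero} _ with y <? x
  ... | yes y<x rewrite filter-accept (_<? x) {xs = p} y<x = +-comm _ 1
  ... | no  y≮x rewrite filter-reject (_<? x) {xs = p} y≮x = +-identityʳ _
  count-below-deleteAt x (y ∷ p) {suc i} (s≤s i<) with y <? x
  ... | yes y<x rewrite filter-accept (_<? x) {xs = p} y<x | filter-accept (_<? x) {xs = deleteAt i p} y<x =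
    cong suc (count-below-deleteAt x p i<)
  ... | no  y≮x rewrite filter-reject (_<? x) {xs = p} y≮x | filter-reject (_<? x) {xs = deleteAt i p} y≮x =
    count-below-deleteAt x p i<

  lowerAbove : ℕ → ℕ → ℕ
  lowerAbove a y = y ∸ 𝟙 (a <? y)

  deletionPattern : List ℕ → ℕ → List ℕ
  deletionPattern p i = map (lowerAbove (entry p i)) (deleteAt i p)

  standardize-deleteAt : ∀ {n p i} → IsPermutation n p → i < length p →
                         standardize (deleteAt i p) ≡ deletionPattern p i
  standardize-deleteAt {p = p} {i} π i< = map-cong-local (All.tabulate rank-after-deletion)
    where
    rank-after-deletion : ∀ {x} → x ∈ deleteAt i p →
                          length (filter (_<? x) (deleteAt i p)) ≡ lowerAbove (entry p i) x
    rank-after-deletion {x} x∈ = begin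
      length (filter (_<? x) (deleteAt i p))            ≡⟨ m+n∸n≡m _ δ ⟨
      length (filter (_<? x) (deleteAt i p)) + δ ∸ δ    ≡⟨ cong (_∸ δ) (count-below-deleteAt x p i<) ⟩
      length (filter (_<? x) p) ∸ δ                     ≡⟨ cong (_∸ δ) (count-below-permutation π (∈-deleteAt⁻ p x∈)) ⟩
      x ∸ δ                                             ∎
      where
      open ≡-Reasoning
      δ = 𝟙 (entry p i <? x)

  Consecutive : ℕ → ℕ → Set
  Consecutive x y = suc x ≡ y ⊎ suc y ≡ x

  consecutive? : ∀ x y → Dec (Consecutive x y)
  consecutive? x y = (suc x ≟ y) ⊎-dec (suc y ≟ x)

  bond : ℕ → ℕ → ℕ
  bond x y = 𝟙 (consecutive? x y)

  bonds : List ℕ → ℕ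
  bonds []          = 0
  bonds (x ∷ [])    = 0
  bonds (x ∷ y ∷ p) = bond x y + bonds (y ∷ p)

  suc-∸1 : ∀ {m n} → m < n → suc (n ∸ 1) ≡ n
  suc-∸1 m<n = m+[n∸m]≡n (≤-trans (s≤s z≤n) m<n)

  lowerAbove-< : ∀ {a y} → a < y → lowerAbove a y ≡ y ∸ 1
  lowerAbove-< {a} {y} a<y = cong (y ∸_) (𝟙-yes (a <? y) a<y)

  lowerAbove-≮ : ∀ {a y} → ¬ a < y → lowerAbove a y ≡ y
  lowerAbove-≮ {a} {y} a≮y = cong (y ∸_) (𝟙-no (a <? y) a≮y)

  lowerAbove-consecutive : ∀ {x y w} → Consecutive x y → w ≢ x → w ≢ y →
                           lowerAbove x w ≡ lowerAbove y w
  lowerAbove-consecutive {x} {y} {w} (inj₁ sx≡y) _ w≢y =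
    cong (w ∸_) (𝟙-cong (x <? w) (y <? w) (step-up sx≡y w≢y) (step-down sx≡y))
    where
    step-up : ∀ {a b} → suc a ≡ b → w ≢ b → a < w → b < w
    step-up refl w≢b a<w = ≤∧≢⇒< a<w (w≢b ∘ sym)
    step-down : ∀ {a b} → suc a ≡ b → b < w → a < w
    step-down refl = <-trans (n<1+n _)
  lowerAbove-consecutive (inj₂ sy≡x) w≢x w≢y =
    sym (lowerAbove-consecutive (inj₁ sy≡x) w≢y w≢x)

  lowerAbove-swap : ∀ {x y} → Consecutive x y → lowerAbove x y ≡ lowerAbove y x
  lowerAbove-swap {x} (inj₁ refl) = trans (lowerAbove-< (n<1+n x)) (sym (lowerAbove-≮ (<-asym (n<1+n x))))
  lowerAbove-swap {_} {y} (inj₂ refl) = trans (lowerAbove-≮ (<-asym (n<1+n y))) (sym (lowerAbove-< (n<1+n y)))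

  consecutive-lowerAbove : ∀ {a x y} → a ≢ y → x ≢ y → lowerAbove a y ≡ lowerAbove y x → Consecutive x y
  consecutive-lowerAbove {a} {x} {y} _ x≢y eq with a <? y | y <? x
  ... | no  _   | no  _   = contradiction (sym eq) x≢y
  ... | yes a<y | no  _   = inj₁ (trans (cong suc (sym eq)) (suc-∸1 a<y))
  ... | no  _   | yes y<x = inj₂ (trans (cong suc eq) (suc-∸1 y<x))
  ... | yes a<y | yes y<x = contradiction (trans (sym (suc-∸1 y<x)) (trans (cong suc (sym eq)) (suc-∸1 a<y))) x≢y

  deletionPattern-consecutive : ∀ p {i} → Unique p → suc i < length p →
    Consecutive (entry p i) (entry p (suc i)) → deletionPattern p i ≡ deletionPattern p (suc i)
  deletionPattern-consecutive (x ∷ y ∷ r) {zero} (x∉ ∷ y∉ ∷ _) _ c =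
    cong₂ _∷_ (lowerAbove-swap c)
      (map-cong-local (All.tabulate λ w∈ → lowerAbove-consecutive c
        (λ w≡x → All.lookup x∉ (there w∈) (sym w≡x)) (λ w≡y → All.lookup y∉ w∈ (sym w≡y))))
  deletionPattern-consecutive (w ∷ p) {suc i} (w∉ ∷ u) (s≤s i<) c =
    cong₂ _∷_
      (lowerAbove-consecutive c (All.lookup w∉ (entry-∈ p (<-trans (n<1+n i) i<)))
                                (All.lookup w∉ (entry-∈ p i<)))
      (deletionPattern-consecutive p u i< c)

  entry-deletionPattern-< : ∀ p {i k} → k < i → i < length p →
    entry (deletionPattern p i) k ≡ lowerAbove (entry p i) (entry p k)
  entry-deletionPattern-< p {i} {k} k<i i< = begin
    entry (map (lowerAbove (entry p i)) (deleteAt i p)) k ≡⟨ entry-map _ (deleteAt i p) k<len ⟩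
    lowerAbove (entry p i) (entry (deleteAt i p) k)     ≡⟨ cong (lowerAbove (entry p i)) (entry-deleteAt-< p k<i) ⟩
    lowerAbove (entry p i) (entry p k)                  ∎
    where
    open ≡-Reasoning
    k<len : k < length (deleteAt i p)
    k<len = ≤-trans k<i (≤-pred (≤-trans i< (≤-reflexive (sym (length-deleteAt p i<)))))

  entry-deletionPattern-≥ : ∀ p {i k} → i ≤ k → suc k < length p →
    entry (deletionPattern p i) k ≡ lowerAbove (entry p i) (entry p (suc k))
  entry-deletionPattern-≥ p {i} {k} i≤k sk< = begin
    entry (map (lowerAbove (entry p i)) (deleteAt i p)) k ≡⟨ entry-map _ (deleteAt i p) k<len ⟩
    lowerAbove (entry p i) (entry (deleteAt i p) k)     ≡⟨ cong (lowerAbove (entry p i)) (entry-deleteAt-≥ p i≤k) ⟩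
    lowerAbove (entry p i) (entry p (suc k))            ∎
    where
    open ≡-Reasoning
    i< = ≤-<-trans i≤k (<-trans (n<1+n k) sk<)
    k<len : k < length (deleteAt i p)
    k<len = ≤-pred (≤-trans sk< (≤-reflexive (sym (length-deleteAt p i<))))

  -- Compare both patterns at position k: only a bond between entries k and k+1 reconciles them.
  consecutive-deletionPattern : ∀ p {j k} → Unique p → j ≤ k → suc k < length p →
    deletionPattern p j ≡ deletionPattern p (suc k) → Consecutive (entry p k) (entry p (suc k))
  consecutive-deletionPattern p {j} {k} u j≤k sk< eq =
    consecutive-lowerAbove (distinct j≤k)
                           (distinct ≤-refl)
                           (begin
      lowerAbove (entry p j) (entry p (suc k)) ≡⟨ entry-deletionPattern-≥ p j≤k sk< ⟨
      entry (deletionPattern p j) k            ≡⟨ cong (λ q → entry q k) eq ⟩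
      entry (deletionPattern p (suc k)) k      ≡⟨ entry-deletionPattern-< p (n<1+n k) sk< ⟩
      lowerAbove (entry p (suc k)) (entry p k) ∎)
    where
    open ≡-Reasoning
    distinct : ∀ {i} → i ≤ k → entry p i ≢ entry p (suc k)
    distinct i≤k eq′ = <⇒≢ (s≤s i≤k) (entry-injective p u (≤-<-trans i≤k (<-trans (n<1+n k) sk<)) sk< eq′)

  deletionPattern-contiguous : ∀ p {i j} → Unique p → i < j → j < length p →
    deletionPattern p i ≡ deletionPattern p j → deletionPattern p i ≡ deletionPattern p (suc i)
  deletionPattern-contiguous p {i} {suc k} u (s≤s i≤k) sk< eq with m≤n⇒m<n∨m≡n i≤k
  ... | inj₂ refl = eq
  ... | inj₁ i<k  = deletionPattern-contiguous p u i<k (<-trans (n<1+n k) sk<) (trans eq (sym k≈sk))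
    where
    k≈sk = deletionPattern-consecutive p u sk< (consecutive-deletionPattern p u i≤k sk< eq)

  bonds-as-sumTo : ∀ p → sumTo (λ i → bond (entry p i) (entry p (suc i))) (length p ∸ 1) ≡ bonds p
  bonds-as-sumTo []          = refl
  bonds-as-sumTo (x ∷ [])    = refl
  bonds-as-sumTo (x ∷ y ∷ p) = cong (bond x y +_) (bonds-as-sumTo (y ∷ p))

  _≟ᴸ_ : DecidableEquality (List ℕ)
  _≟ᴸ_ = ≡-dec _≟_

  m-deletionPattern : ∀ {n p} → IsPermutation n p → m p ≡ length (deduplicate _≟ᴸ_ (applyUpTo (deletionPattern p) n))
  m-deletionPattern {n} {p} π = cong (length ∘ deduplicate _≟ᴸ_) (begin
    map (λ i → standardize (deleteAt i p)) (upTo (length p)) ≡⟨ map-cong-local (All.tabulate (standardize-deleteAt π ∘ ∈-upTo⁻)) ⟩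
    map (deletionPattern p) (upTo (length p))               ≡⟨ cong (map (deletionPattern p) ∘ upTo) (length≡ π) ⟩
    map (deletionPattern p) (upTo n)                        ≡⟨ map-applyUpTo (λ i → i) (deletionPattern p) n ⟩
    applyUpTo (deletionPattern p) n                         ∎)
    where open ≡-Reasoning

  m+bonds : ∀ {n p} → IsPermutation (suc n) p → m p + bonds p ≡ suc n
  m+bonds {n} {p} π = begin
    m p + bonds p                                                  ≡⟨ cong₂ _+_ (m-deletionPattern π) bonds≡ ⟩
    length (deduplicate _≟ᴸ_ (applyUpTo (deletionPattern p) (suc n))) + sumTo χ n
                                                                   ≡⟨ length-deduplicate-contiguous _≟ᴸ_ n (deletionPattern p) contiguous ⟩
    suc n                                                          ∎
    where
    open ≡-Reasoning
    u = unique π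
    fit : ∀ {i} → i < suc n → i < length p
    fit i< = ≤-trans i< (≤-reflexive (sym (length≡ π)))
    χ β : ℕ → ℕ
    χ i = 𝟙 (deletionPattern p i ≟ᴸ deletionPattern p (suc i))
    β i = bond (entry p i) (entry p (suc i))
    contiguous : ContiguousFibres (deletionPattern p) n
    contiguous i<j j≤n = deletionPattern-contiguous p u i<j (fit (s≤s j≤n))
    β≡χ : ∀ {i} → i < n → β i ≡ χ i
    β≡χ i<n = 𝟙-cong (consecutive? _ _) (_ ≟ᴸ _)
      (deletionPattern-consecutive p u (fit (s≤s i<n))) (consecutive-deletionPattern p u ≤-refl (fit (s≤s i<n)))
    bonds≡ : bonds p ≡ sumTo χ n
    bonds≡ = begin
      bonds p                 ≡⟨ bonds-as-sumTo p ⟨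
      sumTo β (length p ∸ 1)  ≡⟨ cong (λ l → sumTo β (l ∸ 1)) (length≡ π) ⟩
      sumTo β n               ≡⟨ sumTo-cong n β≡χ ⟩
      sumTo χ n               ∎

  -- Inserting the maximum

  insertAt : ℕ → ℕ → List ℕ → List ℕ
  insertAt zero    v p       = v ∷ p
  insertAt (suc j) v []      = v ∷ []
  insertAt (suc j) v (x ∷ p) = x ∷ insertAt j v p

  erase : ℕ → List ℕ → List ℕ
  erase v = filter (¬? ∘ (_≟ v))

  length-insertAt : ∀ j v p → length (insertAt j v p) ≡ suc (length p)
  length-insertAt zero    v p       = refl
  length-insertAt (suc j) v []      = refl
  length-insertAt (suc j) v (x ∷ p) = cong suc (length-insertAt j v p)

  ∈-insertAt⁻ : ∀ j v p {z} → z ∈ insertAt j v p → z ≡ v ⊎ z ∈ p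
  ∈-insertAt⁻ zero    v p       (here z≡v) = inj₁ z≡v
  ∈-insertAt⁻ zero    v p       (there z∈) = inj₂ z∈
  ∈-insertAt⁻ (suc j) v []      (here z≡v) = inj₁ z≡v
  ∈-insertAt⁻ (suc j) v (x ∷ p) (here z≡x) = inj₂ (here z≡x)
  ∈-insertAt⁻ (suc j) v (x ∷ p) (there z∈) = map₂ there (∈-insertAt⁻ j v p z∈)

  Unique-insertAt : ∀ j {v p} → Unique p → v ∉ p → Unique (insertAt j v p)
  Unique-insertAt zero    {p = p}     u v∉ = All.tabulate (λ { z∈ refl → v∉ z∈ }) ∷ u
  Unique-insertAt (suc j) {p = []}    _ _  = [] ∷ []
  Unique-insertAt (suc j) {v} {x ∷ p} (x∉ ∷ u) v∉ =
    All.tabulate x≢ ∷ Unique-insertAt j u (v∉ ∘ there)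
    where
    x≢ : ∀ {z} → z ∈ insertAt j v p → x ≢ z
    x≢ z∈ x≡z with ∈-insertAt⁻ j v p z∈
    ... | inj₁ refl = v∉ (here (sym x≡z))
    ... | inj₂ z∈p  = All.lookup x∉ z∈p x≡z

  erase-∉ : ∀ {v p} → v ∉ p → erase v p ≡ p
  erase-∉ {v} v∉ = filter-all (¬? ∘ (_≟ v)) (All.tabulate (λ { z∈ refl → v∉ z∈ }))

  erase-insertAt : ∀ j {v p} → v ∉ p → erase v (insertAt j v p) ≡ p
  erase-insertAt zero    {v} {p}     v∉ = trans (filter-reject (¬? ∘ (_≟ v)) {xs = p} (λ v≢v → v≢v refl)) (erase-∉ v∉)
  erase-insertAt (suc j) {v} {[]}    _  = filter-reject (¬? ∘ (_≟ v)) {xs = []} (λ v≢v → v≢v refl)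
  erase-insertAt (suc j) {v} {x ∷ p} v∉ =
    trans (filter-accept (¬? ∘ (_≟ v)) {xs = insertAt j v p} (λ x≡v → v∉ (here (sym x≡v))))
          (cong (x ∷_) (erase-insertAt j (v∉ ∘ there)))

  insertAt-injectiveˡ : ∀ {v p i j} → v ∉ p → i ≤ length p → j ≤ length p →
                        insertAt i v p ≡ insertAt j v p → i ≡ j
  insertAt-injectiveˡ {p = p}     {zero}  {zero}  _ _ _ _ = refl
  insertAt-injectiveˡ {p = x ∷ p} {zero}  {suc j} v∉ _ _ eq = contradiction (here (∷-injectiveˡ eq)) v∉
  insertAt-injectiveˡ {p = x ∷ p} {suc i} {zero}  v∉ _ _ eq = contradiction (here (sym (∷-injectiveˡ eq))) v∉
  insertAt-injectiveˡ {p = x ∷ p} {suc i} {suc j} v∉ (s≤s i≤) (s≤s j≤) eq =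
    cong suc (insertAt-injectiveˡ (v∉ ∘ there) i≤ j≤ (∷-injectiveʳ eq))

  insertAt-erase : ∀ {v z} → Unique z → v ∈ z → ∃[ j ] j ≤ length (erase v z) × insertAt j v (erase v z) ≡ z
  insertAt-erase {v} {x ∷ z} (x∉ ∷ _) (here refl) =
    0 , z≤n , cong (v ∷_) (trans (filter-reject (¬? ∘ (_≟ v)) {xs = z} (λ v≢v → v≢v refl))
                                 (erase-∉ (λ v∈ → All.lookup x∉ v∈ refl)))
  insertAt-erase {v} {x ∷ z} (x∉ ∷ u) (there v∈)
    with j , j≤ , eq ← insertAt-erase u v∈
    rewrite filter-accept (¬? ∘ (_≟ v)) {xs = z} (All.lookup x∉ v∈)
    = suc j , s≤s j≤ , cong (x ∷_) eq

  insertions : ℕ → List ℕ → List (List ℕ)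
  insertions n p = applyUpTo (λ j → insertAt j n p) (suc n)

  n∉permutation : ∀ {n p} → IsPermutation n p → n ∉ p
  n∉permutation π n∈ = <-irrefl refl (All.lookup (bounded π) n∈)

  IsPermutation-insertAt : ∀ {n p} j → IsPermutation n p → IsPermutation (suc n) (insertAt j n p)
  IsPermutation-insertAt {n} {p} j π = isPermutation
    (Unique-insertAt j (unique π) (n∉permutation π))
    (trans (length-insertAt j n p) (cong suc (length≡ π)))
    (All.tabulate below)
    where
    below : ∀ {z} → z ∈ insertAt j n p → z < suc n
    below z∈ with ∈-insertAt⁻ j n p z∈
    ... | inj₁ refl = n<1+n n
    ... | inj₂ z∈p  = m<n⇒m<1+n (All.lookup (bounded π) z∈p)

  IsPermutation-erase : ∀ {n z} j → IsPermutation (suc n) z → insertAt j n (erase n z) ≡ z →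
                        IsPermutation n (erase n z)
  IsPermutation-erase {n} {z} j π eq = isPermutation
    (Unique.filter⁺ (¬? ∘ (_≟ n)) (unique π))
    (suc-injective (trans (sym (length-insertAt j n (erase n z))) (trans (cong length eq) (length≡ π))))
    (All.tabulate below)
    where
    below : ∀ {w} → w ∈ erase n z → w < n
    below w∈ with w∈z , w≢n ← ∈-filter⁻ (¬? ∘ (_≟ n)) {xs = z} w∈ =
      ≤∧≢⇒< (≤-pred (All.lookup (bounded π) w∈z)) w≢n

  S-suc-⊆ : ∀ n {z} → z ∈ S (suc n) → z ∈ concatMap (insertions n) (S n)
  S-suc-⊆ n {z} z∈ with π ← ∈-S⁻ z∈ with j , j≤ , eq ← insertAt-erase (unique π) (∈-permutation π (n<1+n n)) =
    ∈-concatMap⁺ (insertions n) (Any.map (λ { refl → z∈insertions }) (∈-S⁺ πₑ))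
    where
    πₑ = IsPermutation-erase j π eq
    z∈insertions : z ∈ insertions n (erase n z)
    z∈insertions = subst (_∈ insertions n (erase n z)) eq
      (∈-applyUpTo⁺ (λ i → insertAt i n (erase n z)) (s≤s (≤-trans j≤ (≤-reflexive (length≡ πₑ)))))

  S-suc-⊇ : ∀ n {z} → z ∈ concatMap (insertions n) (S n) → z ∈ S (suc n)
  S-suc-⊇ n {z} z∈
    with p , p∈ , z∈′ ← find (∈-concatMap⁻ (insertions n) {xs = S n} z∈)
    with j , _ , refl ← ∈-applyUpTo⁻ (λ j → insertAt j n p) z∈′
    = ∈-S⁺ (IsPermutation-insertAt j (∈-S⁻ p∈))

  Unique-insertions : ∀ n → Unique (concatMap (insertions n) (S n))
  Unique-insertions n = Unique-concatMap (insertions n) (Unique-S n)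
    (λ p∈ → Unique.applyUpTo⁺₁ (λ j → insertAt j n _) (suc n) λ i<j j<sn eq →
       let π = ∈-S⁻ p∈
           j≤ = ≤-trans (≤-pred j<sn) (≤-reflexive (sym (length≡ π))) in
       <⇒≢ i<j (insertAt-injectiveˡ (n∉permutation π) (≤-trans (<⇒≤ i<j) j≤) j≤ eq))
    same-source
    where
    same-source : ∀ {p q z} → p ∈ S n → q ∈ S n → z ∈ insertions n p → z ∈ insertions n q → p ≡ q
    same-source {p} {q} p∈ q∈ z∈p z∈q
      with i , _ , refl ← ∈-applyUpTo⁻ (λ j → insertAt j n p) z∈p
      with j , _ , eq   ← ∈-applyUpTo⁻ (λ j → insertAt j n q) z∈q
      = trans (sym (erase-insertAt i (n∉permutation (∈-S⁻ p∈))))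
              (trans (cong (erase n) eq) (erase-insertAt j (n∉permutation (∈-S⁻ q∈))))

  S-suc-↭ : ∀ n → S (suc n) ↭ concatMap (insertions n) (S n)
  S-suc-↭ n = ∼bag⇒↭ (unique∧set⇒bag (Unique-S (suc n)) (Unique-insertions n) (mk⇔ (S-suc-⊆ n) (S-suc-⊇ n)))

  sumMap-S-suc : ∀ n f → sumMap f (S (suc n)) ≡ sumMap (λ p → sumTo (λ j → f (insertAt j n p)) (suc n)) (S n)
  sumMap-S-suc n f = begin
    sum (map f (S (suc n)))                         ≡⟨ sum-↭ (Perm.map⁺ f (S-suc-↭ n)) ⟩
    sumMap f (concatMap (insertions n) (S n))       ≡⟨ sumMap-concatMap f (insertions n) (S n) ⟩
    sumMap (sumMap f ∘ insertions n) (S n)          ≡⟨ sumMap-cong (S n) (λ {p} _ → sumMap-applyUpTo f (λ j → insertAt j n p) (suc n)) ⟩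
    sumMap (λ p → sumTo (λ j → f (insertAt j n p)) (suc n)) (S n) ∎
    where open ≡-Reasoning

  -- Bonds broken and created by an insertion

  bond-sym : ∀ x y → bond x y ≡ bond y x
  bond-sym x y = 𝟙-cong (consecutive? x y) (consecutive? y x) swap swap

  bond-idem : ∀ x y → bond x y * bond x y ≡ bond x y
  bond-idem x y = 𝟙-idem (consecutive? x y)

  bond-pred : ∀ w → bond w (suc w) ≡ 1
  bond-pred w = 𝟙-yes (consecutive? w (suc w)) (inj₁ refl)

  bond-≢pred : ∀ {x w} → x < suc w → x ≢ w → bond x (suc w) ≡ 0
  bond-≢pred {x} {w} x<sw x≢w = 𝟙-no (consecutive? x (suc w))
    λ { (inj₁ sx≡sw) → x≢w (suc-injective sx≡sw) ; (inj₂ refl) → <-irrefl refl (<-trans (n<1+n (suc w)) x<sw) }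

  bond-below-pred : ∀ {x v} → x < v → bond x (suc v) ≡ 0
  bond-below-pred x<v = bond-≢pred (m<n⇒m<1+n x<v) (<⇒≢ x<v)

  -- The bond between entries j-1 and j of p, which an insertion at position j breaks.
  brokenBond : ℕ → List ℕ → ℕ
  brokenBond zero          _           = 0
  brokenBond (suc _)       []          = 0
  brokenBond (suc zero)    (x ∷ [])    = 0
  brokenBond (suc zero)    (x ∷ y ∷ _) = bond x y
  brokenBond (suc (suc j)) (x ∷ p)     = brokenBond (suc j) p

  -- The bond that v, inserted at position j, forms with its right neighbour.
  rightBond : ℕ → ℕ → List ℕ → ℕ
  rightBond _       v []      = 0
  rightBond zero    v (x ∷ _) = bond x v
  rightBond (suc j) v (x ∷ p) = rightBond j v p

  leftBond : ℕ → ℕ → List ℕ → ℕ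
  leftBond zero    v p = 0
  leftBond (suc j) v p = rightBond j v p

  newBonds : ℕ → ℕ → List ℕ → ℕ
  newBonds j v p = leftBond j v p + rightBond j v p

  neighbours : ℕ → List ℕ → ℕ
  neighbours v = sumMap (λ x → bond x v)

  bondsMeeting : ℕ → List ℕ → ℕ
  bondsMeeting v []          = 0
  bondsMeeting v (x ∷ [])    = 0
  bondsMeeting v (x ∷ y ∷ p) = bond x y * (bond x v + bond y v) + bondsMeeting v (y ∷ p)

  private
    rotate-bonds : ∀ a b c d → a + (b + c) + d ≡ d + c + (a + b)
    rotate-bonds = solve-∀

  bonds-insertAt : ∀ j v p → j ≤ length p → bonds (insertAt j v p) + brokenBond j p ≡ bonds p + newBonds j v p
  bonds-insertAt zero v []      _ = refl
  bonds-insertAt zero v (x ∷ p) _ = begin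
    bond v x + bonds (x ∷ p) + 0  ≡⟨ +-identityʳ _ ⟩
    bond v x + bonds (x ∷ p)      ≡⟨ cong (_+ bonds (x ∷ p)) (bond-sym v x) ⟩
    bond x v + bonds (x ∷ p)      ≡⟨ +-comm (bond x v) _ ⟩
    bonds (x ∷ p) + bond x v      ∎
    where open ≡-Reasoning
  bonds-insertAt (suc zero) v (x ∷ [])    _ = +-identityʳ _
  bonds-insertAt (suc zero) v (x ∷ y ∷ p) _ = begin
    bond x v + (bond v y + bonds (y ∷ p)) + bond x y   ≡⟨ cong (λ t → bond x v + (t + bonds (y ∷ p)) + bond x y) (bond-sym v y) ⟩
    bond x v + (bond y v + bonds (y ∷ p)) + bond x y   ≡⟨ rotate-bonds (bond x v) (bond y v) (bonds (y ∷ p)) (bond x y) ⟩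
    bond x y + bonds (y ∷ p) + (bond x v + bond y v)   ∎
    where open ≡-Reasoning
  bonds-insertAt (suc (suc j)) v (x ∷ y ∷ p) (s≤s j≤) = begin
    bond x y + bonds (insertAt (suc j) v (y ∷ p)) + brokenBond (suc j) (y ∷ p)  ≡⟨ +-assoc (bond x y) _ _ ⟩
    bond x y + (bonds (insertAt (suc j) v (y ∷ p)) + brokenBond (suc j) (y ∷ p)) ≡⟨ cong (bond x y +_) (bonds-insertAt (suc j) v (y ∷ p) j≤) ⟩
    bond x y + (bonds (y ∷ p) + newBonds (suc j) v (y ∷ p))                      ≡⟨ +-assoc (bond x y) _ _ ⟨
    bond x y + bonds (y ∷ p) + newBonds (suc j) v (y ∷ p)                        ∎
    where open ≡-Reasoning

  sumTo-brokenBond : ∀ p → sumTo (λ j → brokenBond j p) (suc (length p)) ≡ bonds p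
  sumTo-brokenBond []      = refl
  sumTo-brokenBond (x ∷ p) = shifted x p
    where
    shifted : ∀ x p → sumTo (λ j → brokenBond (suc j) (x ∷ p)) (suc (length p)) ≡ bonds (x ∷ p)
    shifted x []      = refl
    shifted x (y ∷ p) = cong (bond x y +_) (shifted y p)

  sumTo-rightBond : ∀ v p → sumTo (λ j → rightBond j v p) (suc (length p)) ≡ neighbours v p
  sumTo-rightBond v []      = refl
  sumTo-rightBond v (x ∷ p) = cong (bond x v +_) (sumTo-rightBond v p)

  rightBond-end : ∀ v p → rightBond (length p) v p ≡ 0
  rightBond-end v []      = refl
  rightBond-end v (x ∷ p) = rightBond-end v p

  sumTo-leftBond : ∀ v p → sumTo (λ j → leftBond j v p) (suc (length p)) ≡ neighbours v p
  sumTo-leftBond v p = begin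
    sumTo ρ (length p)                        ≡⟨ +-identityʳ _ ⟨
    sumTo ρ (length p) + 0                    ≡⟨ cong (sumTo ρ (length p) +_) (rightBond-end v p) ⟨
    sumTo ρ (length p) + ρ (length p)         ≡⟨ sumTo-suc (length p) ρ ⟨
    sumTo ρ (suc (length p))                  ≡⟨ sumTo-rightBond v p ⟩
    neighbours v p                            ∎
    where
    open ≡-Reasoning
    ρ = λ j → rightBond j v p

  sumTo-brokenBond*newBonds : ∀ v p →
    sumTo (λ j → brokenBond j p * newBonds j v p) (suc (length p)) ≡ bondsMeeting v p
  sumTo-brokenBond*newBonds v []      = refl
  sumTo-brokenBond*newBonds v (x ∷ p) = shifted x p
    where
    shifted : ∀ x p →
      sumTo (λ j → brokenBond (suc j) (x ∷ p) * newBonds (suc j) v (x ∷ p)) (suc (length p)) ≡ bondsMeeting v (x ∷ p)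
    shifted x []      = refl
    shifted x (y ∷ p) = cong (bond x y * (bond x v + bond y v) +_) (shifted y p)

  consecutive-below : ∀ {x v} → x < v → Consecutive x v → suc x ≡ v
  consecutive-below _   (inj₁ sx≡v) = sx≡v
  consecutive-below x<v (inj₂ refl) = contradiction x<v (<-asym (n<1+n _))

  bond*bond-below : ∀ {x y v} → x ≢ y → x < v → y < v → bond x v * bond y v ≡ 0
  bond*bond-below {x} {y} {v} x≢y x<v y<v = 𝟙*𝟙 (consecutive? x v) (consecutive? y v)
    λ (cx , cy) → x≢y (suc-injective (trans (consecutive-below x<v cx) (sym (consecutive-below y<v cy))))

  neighbours-∉ : ∀ {w q} → w ∉ q → All (_< suc w) q → neighbours (suc w) q ≡ 0
  neighbours-∉ {q = []}    _  _          = refl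
  neighbours-∉ {q = x ∷ q} w∉ (x< ∷ q<) =
    cong₂ _+_ (bond-≢pred x< (λ x≡w → w∉ (here (sym x≡w)))) (neighbours-∉ (w∉ ∘ there) q<)

  neighbours-unique : ∀ {w p} → Unique p → w ∈ p → All (_< suc w) p → neighbours (suc w) p ≡ 1
  neighbours-unique {w} (x∉ ∷ _) (here refl) (_ ∷ q<) =
    cong₂ _+_ (bond-pred w) (neighbours-∉ (λ w∈ → All.lookup x∉ w∈ refl) q<)
  neighbours-unique (x∉ ∷ u) (there w∈) (x< ∷ q<) =
    cong₂ _+_ (bond-≢pred x< (All.lookup x∉ w∈)) (neighbours-unique u w∈ q<)

  rightBond*rightBond-suc : ∀ j {v p} → Unique p → All (_< v) p → rightBond j v p * rightBond (suc j) v p ≡ 0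
  rightBond*rightBond-suc j       {p = []}        _            _                 = refl
  rightBond*rightBond-suc zero {v} {x ∷ []}       _            _                 = *-zeroʳ (bond x v)
  rightBond*rightBond-suc zero    {p = x ∷ y ∷ _} (x∉ ∷ _)     (x< ∷ y< ∷ _)     = bond*bond-below (All.lookup x∉ (here refl)) x< y<
  rightBond*rightBond-suc (suc j) {p = _ ∷ p}     (_ ∷ u)      (_ ∷ p<)          = rightBond*rightBond-suc j u p<

  leftBond*rightBond : ∀ j {v p} → Unique p → All (_< v) p → leftBond j v p * rightBond j v p ≡ 0
  leftBond*rightBond zero    _ _  = refl
  leftBond*rightBond (suc j) u p< = rightBond*rightBond-suc j u p<

  brokenBond-idem : ∀ j p → brokenBond j p * brokenBond j p ≡ brokenBond j p
  brokenBond-idem zero          _           = refl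
  brokenBond-idem (suc _)       []          = refl
  brokenBond-idem (suc zero)    (x ∷ [])    = refl
  brokenBond-idem (suc zero)    (x ∷ y ∷ _) = bond-idem x y
  brokenBond-idem (suc (suc j)) (x ∷ p)     = brokenBond-idem (suc j) p

  rightBond-idem : ∀ j v p → rightBond j v p * rightBond j v p ≡ rightBond j v p
  rightBond-idem _       v []      = refl
  rightBond-idem zero    v (x ∷ _) = bond-idem x v
  rightBond-idem (suc j) v (x ∷ p) = rightBond-idem j v p

  leftBond-idem : ∀ j v p → leftBond j v p * leftBond j v p ≡ leftBond j v p
  leftBond-idem zero    v p = refl
  leftBond-idem (suc j) v p = rightBond-idem j v p

  private
    square-+ : ∀ l r → (l + r) * (l + r) ≡ l * l + r * r + 2 * (l * r)
    square-+ = solve-∀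

  newBonds-idem : ∀ j {v p} → Unique p → All (_< v) p → newBonds j v p * newBonds j v p ≡ newBonds j v p
  newBonds-idem j {v} {p} u p< = begin
    (l + r) * (l + r)               ≡⟨ square-+ l r ⟩
    l * l + r * r + 2 * (l * r)     ≡⟨ cong₂ (λ s t → s + 2 * t) (cong₂ _+_ (leftBond-idem j v p) (rightBond-idem j v p))
                                             (leftBond*rightBond j u p<) ⟩
    l + r + 0                       ≡⟨ +-identityʳ _ ⟩
    l + r                           ∎
    where
    open ≡-Reasoning
    l = leftBond j v p
    r = rightBond j v p

  bond*meeting-below : ∀ {x y v} → x < v → y < v → bond x y * (bond x (suc v) + bond y (suc v)) ≡ 0
  bond*meeting-below {x} {y} x<v y<v =
    trans (cong₂ (λ s t → bond x y * (s + t)) (bond-below-pred x<v) (bond-below-pred y<v)) (*-zeroʳ (bond x y))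

  bondsMeeting-below : ∀ {v} p → All (_< v) p → bondsMeeting (suc v) p ≡ 0
  bondsMeeting-below []          _              = refl
  bondsMeeting-below (x ∷ [])    _              = refl
  bondsMeeting-below (x ∷ y ∷ p) (x< ∷ y< ∷ p<) =
    cong₂ _+_ (bond*meeting-below x< y<) (bondsMeeting-below (y ∷ p) (y< ∷ p<))

  bondsMeeting-insertAt : ∀ j {v} p → All (_< v) p → j ≤ length p →
                          bondsMeeting (suc v) (insertAt j v p) ≡ newBonds j v p
  bondsMeeting-insertAt zero          []          _              _          = refl
  bondsMeeting-insertAt zero {v}      (x ∷ p)     (x< ∷ p<)      _          = begin
    bond v x * (bond v (suc v) + bond x (suc v)) + bondsMeeting (suc v) (x ∷ p)
      ≡⟨ cong₂ (λ s t → bond v x * (s + t) + bondsMeeting (suc v) (x ∷ p)) (bond-pred v) (bond-below-pred x<) ⟩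
    bond v x * 1 + bondsMeeting (suc v) (x ∷ p)
      ≡⟨ cong₂ _+_ (*-identityʳ (bond v x)) (bondsMeeting-below (x ∷ p) (x< ∷ p<)) ⟩
    bond v x + 0
      ≡⟨ trans (+-identityʳ _) (bond-sym v x) ⟩
    bond x v ∎
    where open ≡-Reasoning
  bondsMeeting-insertAt (suc zero) {v} (x ∷ p) (x< ∷ p<) _ = begin
    bond x v * (bond x (suc v) + bond v (suc v)) + bondsMeeting (suc v) (v ∷ p)
      ≡⟨ cong₂ (λ s t → bond x v * (s + t) + bondsMeeting (suc v) (v ∷ p)) (bond-below-pred x<) (bond-pred v) ⟩
    bond x v * 1 + bondsMeeting (suc v) (v ∷ p)
      ≡⟨ cong₂ _+_ (*-identityʳ (bond x v)) (bondsMeeting-insertAt zero p p< z≤n) ⟩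
    bond x v + rightBond 0 v p ∎
    where open ≡-Reasoning
  bondsMeeting-insertAt (suc (suc j)) (x ∷ y ∷ p) (x< ∷ y< ∷ p<) (s≤s j≤) =
    cong₂ _+_ (bond*meeting-below x< y<) (bondsMeeting-insertAt (suc j) (y ∷ p) (y< ∷ p<) j≤)

  private
    expand-cross : ∀ X a B b → X * X + 2 * (B * a) + 2 * (a * b) ≡ X * X + 2 * ((B + b) * a)
    expand-cross = solve-∀
    complete-square : ∀ X a → X * X + 2 * ((X + a) * a) ≡ (X + a) * (X + a) + a * a
    complete-square = solve-∀
    expand-square : ∀ B b a → (B + b) * (B + b) + a ≡ B * B + 2 * (B * b) + b * b + a
    expand-square = solve-∀

  -- X = B + b - a squared, kept free of subtraction; a is 0 or 1.
  square-balance : ∀ X a B b → X + a ≡ B + b → a * a ≡ a →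
                   X * X + 2 * (B * a) + 2 * (a * b) ≡ B * B + 2 * (B * b) + b * b + a
  square-balance X a B b balance a²≡a = begin
    X * X + 2 * (B * a) + 2 * (a * b)  ≡⟨ expand-cross X a B b ⟩
    X * X + 2 * ((B + b) * a)          ≡⟨ cong (λ t → X * X + 2 * (t * a)) balance ⟨
    X * X + 2 * ((X + a) * a)          ≡⟨ complete-square X a ⟩
    (X + a) * (X + a) + a * a          ≡⟨ cong₂ (λ s t → s * s + t) balance a²≡a ⟩
    (B + b) * (B + b) + a              ≡⟨ expand-square B b a ⟩
    B * B + 2 * (B * b) + b * b + a    ∎
    where open ≡-Reasoning

  -- n = suc w ≥ 1 ensures that n - 1, the only value that can bond with n, occurs in p.
  module InsertMaximum {w p} (π : IsPermutation (suc w) p) where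

    private
      n = suc w
      B = bonds p
      a b X : ℕ → ℕ
      a j = brokenBond j p
      b j = newBonds j n p
      X j = bonds (insertAt j n p)

      Σ : (ℕ → ℕ) → ℕ
      Σ f = sumTo f (suc n)

      Σ-length : ∀ f → sumTo f (suc (length p)) ≡ Σ f
      Σ-length f = cong (λ l → sumTo f (suc l)) (length≡ π)

      j≤length : ∀ {j} → j < suc n → j ≤ length p
      j≤length j< = ≤-trans (≤-pred j<) (≤-reflexive (sym (length≡ π)))

      neighbours-n : neighbours n p ≡ 1
      neighbours-n = neighbours-unique (unique π) (∈-permutation π (n<1+n w)) (bounded π)

      Σa : Σ a ≡ B
      Σa = trans (sym (Σ-length a)) (sumTo-brokenBond p)

      Σb : Σ b ≡ 2
      Σb = begin
        Σ b                    ≡⟨ sumTo-+ (suc n) L R ⟩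
        Σ L + Σ R              ≡⟨ cong₂ _+_ (Σ-length L) (Σ-length R) ⟨
        sumTo L (suc (length p)) + sumTo R (suc (length p))
                               ≡⟨ cong₂ _+_ (sumTo-leftBond n p) (sumTo-rightBond n p) ⟩
        neighbours n p + neighbours n p
                               ≡⟨ cong₂ _+_ neighbours-n neighbours-n ⟩
        2                      ∎
        where
        open ≡-Reasoning
        L R : ℕ → ℕ
        L j = leftBond j n p
        R j = rightBond j n p

      Σab : Σ (λ j → a j * b j) ≡ bondsMeeting n p
      Σab = trans (sym (Σ-length (λ j → a j * b j))) (sumTo-brokenBond*newBonds n p)

      Σbb : Σ (λ j → b j * b j) ≡ 2
      Σbb = trans (sumTo-cong (suc n) (λ {j} _ → newBonds-idem j (unique π) (bounded π))) Σb

      balance : ∀ {j} → j < suc n → X j + a j ≡ B + b j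
      balance {j} j< = bonds-insertAt j n p (j≤length j<)

    sumTo-bonds-insertAt : Σ X ≡ n * B + 2
    sumTo-bonds-insertAt = +-cancelʳ-≡ B _ _ (begin
      Σ X + B                    ≡⟨ cong (Σ X +_) Σa ⟨
      Σ X + Σ a                  ≡⟨ sumTo-+ (suc n) X a ⟨
      Σ (λ j → X j + a j)        ≡⟨ sumTo-cong (suc n) balance ⟩
      Σ (λ j → B + b j)          ≡⟨ sumTo-+ (suc n) (λ _ → B) b ⟩
      Σ (λ _ → B) + Σ b          ≡⟨ cong₂ _+_ (sumTo-const (suc n) B) Σb ⟩
      suc n * B + 2              ≡⟨ +-assoc B (n * B) 2 ⟩
      B + (n * B + 2)            ≡⟨ +-comm B (n * B + 2) ⟩
      n * B + 2 + B              ∎)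
      where open ≡-Reasoning

    sumTo-bondsMeeting-insertAt : Σ (λ j → bondsMeeting (suc n) (insertAt j n p)) ≡ 2
    sumTo-bondsMeeting-insertAt =
      trans (sumTo-cong (suc n) (λ j< → bondsMeeting-insertAt _ p (bounded π) (j≤length j<))) Σb

    sumTo-bonds²-insertAt : Σ (λ j → X j * X j) + 2 * (B * B) + 2 * bondsMeeting n p ≡ suc n * (B * B) + 5 * B + 2
    sumTo-bonds²-insertAt = begin
      Σ XX + 2 * (B * B) + 2 * bondsMeeting n p      ≡⟨ cong₂ (λ s t → Σ XX + 2 * (B * s) + 2 * t) Σa Σab ⟨
      Σ XX + 2 * (B * Σ a) + 2 * Σ ab                ≡⟨ cong₂ (λ s t → Σ XX + s + t) (sumTo-*-* (suc n) 2 B a) (sumTo-* (suc n) 2 ab) ⟨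
      Σ XX + Σ 2Ba + Σ 2ab                           ≡⟨ cong (_+ Σ 2ab) (sumTo-+ (suc n) XX 2Ba) ⟨
      Σ (λ j → XX j + 2Ba j) + Σ 2ab                 ≡⟨ sumTo-+ (suc n) (λ j → XX j + 2Ba j) 2ab ⟨
      Σ (λ j → XX j + 2Ba j + 2ab j)                 ≡⟨ sumTo-cong (suc n) (λ {j} j< → square-balance (X j) (a j) B (b j) (balance j<) (brokenBond-idem j p)) ⟩
      Σ (λ j → BB+2Bb j + bb j + a j)                ≡⟨ sumTo-+ (suc n) (λ j → BB+2Bb j + bb j) a ⟩
      Σ (λ j → BB+2Bb j + bb j) + Σ a                ≡⟨ cong (_+ Σ a) (sumTo-+ (suc n) BB+2Bb bb) ⟩
      Σ BB+2Bb + Σ bb + Σ a                          ≡⟨ cong (λ s → s + Σ bb + Σ a) (sumTo-+ (suc n) (λ _ → B * B) 2Bb) ⟩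
      Σ (λ _ → B * B) + Σ 2Bb + Σ bb + Σ a           ≡⟨ cong₂ (λ s t → s + t + Σ bb + Σ a) (sumTo-const (suc n) (B * B)) (sumTo-*-* (suc n) 2 B b) ⟩
      suc n * (B * B) + 2 * (B * Σ b) + Σ bb + Σ a   ≡⟨ cong₂ (λ s t → suc n * (B * B) + 2 * (B * s) + t + Σ a) Σb Σbb ⟩
      suc n * (B * B) + 2 * (B * 2) + 2 + Σ a        ≡⟨ cong (suc n * (B * B) + 2 * (B * 2) + 2 +_) Σa ⟩
      suc n * (B * B) + 2 * (B * 2) + 2 + B          ≡⟨ collect (suc n * (B * B)) B ⟩
      suc n * (B * B) + 5 * B + 2                    ∎
      where
      open ≡-Reasoning
      XX 2Ba 2ab ab bb 2Bb BB+2Bb : ℕ → ℕ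
      XX j = X j * X j
      ab j = a j * b j
      bb j = b j * b j
      2Ba j = 2 * (B * a j)
      2ab j = 2 * ab j
      2Bb j = 2 * (B * b j)
      BB+2Bb j = B * B + 2Bb j
      collect : ∀ Q B → Q + 2 * (B * 2) + 2 + B ≡ Q + 5 * B + 2
      collect = solve-∀

  -- Sums over S n

  totalBonds totalBonds² totalMeeting : ℕ → ℕ
  totalBonds   n = sumMap bonds (S n)
  totalBonds²  n = sumMap (λ p → bonds p * bonds p) (S n)
  totalMeeting n = sumMap (bondsMeeting n) (S n)

  sumMap-S-suc-by : ∀ n f g → (∀ {p} → IsPermutation n p → sumTo (λ j → f (insertAt j n p)) (suc n) ≡ g p) →
                     sumMap f (S (suc n)) ≡ sumMap g (S n)
  sumMap-S-suc-by n f g per = trans (sumMap-S-suc n f) (sumMap-cong (S n) (per ∘ ∈-S⁻))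

  length-S : ∀ n → length (S n) ≡ n !
  length-S zero    = refl
  length-S (suc n) = begin
    length (S (suc n))        ≡⟨ trans (sumMap-const 1 (S (suc n))) (*-identityʳ _) ⟨
    sumMap (λ _ → 1) (S (suc n)) ≡⟨ sumMap-S-suc-by n (λ _ → 1) (λ _ → suc n) (λ _ → trans (sumTo-const (suc n) 1) (*-identityʳ (suc n))) ⟩
    sumMap (λ _ → suc n) (S n) ≡⟨ sumMap-const (suc n) (S n) ⟩
    length (S n) * suc n      ≡⟨ cong (_* suc n) (length-S n) ⟩
    n ! * suc n               ≡⟨ *-comm (n !) (suc n) ⟩
    suc n !                   ∎
    where open ≡-Reasoning

  totalBonds-suc : ∀ w → totalBonds (2 + w) ≡ suc w * totalBonds (suc w) + length (S (suc w)) * 2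
  totalBonds-suc w = begin
    totalBonds (2 + w)                                  ≡⟨ sumMap-S-suc-by (suc w) bonds _ InsertMaximum.sumTo-bonds-insertAt ⟩
    sumMap (λ p → suc w * bonds p + 2) (S (suc w))      ≡⟨ sumMap-+ _ _ (S (suc w)) ⟩
    sumMap (λ p → suc w * bonds p) (S (suc w)) + sumMap (λ _ → 2) (S (suc w))
                                                        ≡⟨ cong₂ _+_ (sumMap-* (suc w) bonds (S (suc w))) (sumMap-const 2 (S (suc w))) ⟩
    suc w * totalBonds (suc w) + length (S (suc w)) * 2 ∎
    where open ≡-Reasoning

  totalMeeting-suc : ∀ w → totalMeeting (2 + w) ≡ length (S (suc w)) * 2
  totalMeeting-suc w =
    trans (sumMap-S-suc-by (suc w) (bondsMeeting (2 + w)) (λ _ → 2) InsertMaximum.sumTo-bondsMeeting-insertAt)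
          (sumMap-const 2 (S (suc w)))

  totalBonds²-suc : ∀ w → totalBonds² (2 + w) + 2 * totalBonds² (suc w) + 2 * totalMeeting (suc w)
                          ≡ (2 + w) * totalBonds² (suc w) + 5 * totalBonds (suc w) + length (S (suc w)) * 2
  totalBonds²-suc w = begin
    totalBonds² (2 + w) + 2 * sumMap B² Sₙ + 2 * sumMap C Sₙ
      ≡⟨ cong₂ (λ s t → totalBonds² (2 + w) + s + t) (sumMap-* 2 B² Sₙ) (sumMap-* 2 C Sₙ) ⟨
    totalBonds² (2 + w) + sumMap (λ p → 2 * B² p) Sₙ + sumMap (λ p → 2 * C p) Sₙ
      ≡⟨ cong (λ s → s + sumMap (λ p → 2 * B² p) Sₙ + sumMap (λ p → 2 * C p) Sₙ)
              (sumMap-S-suc-by (suc w) B² Σinsertions (λ _ → refl)) ⟩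
    sumMap Σinsertions Sₙ + sumMap (λ p → 2 * B² p) Sₙ + sumMap (λ p → 2 * C p) Sₙ
      ≡⟨ sumMap-+₃ Σinsertions (λ p → 2 * B² p) (λ p → 2 * C p) Sₙ ⟨
    sumMap (λ p → Σinsertions p + 2 * B² p + 2 * C p) Sₙ
      ≡⟨ sumMap-cong Sₙ (InsertMaximum.sumTo-bonds²-insertAt ∘ ∈-S⁻) ⟩
    sumMap (λ p → (2 + w) * B² p + 5 * bonds p + 2) Sₙ
      ≡⟨ sumMap-+₃ (λ p → (2 + w) * B² p) (λ p → 5 * bonds p) (λ _ → 2) Sₙ ⟩
    sumMap (λ p → (2 + w) * B² p) Sₙ + sumMap (λ p → 5 * bonds p) Sₙ + sumMap (λ _ → 2) Sₙ
      ≡⟨ cong₂ (λ s t → s + t + sumMap (λ _ → 2) Sₙ) (sumMap-* (2 + w) B² Sₙ) (sumMap-* 5 bonds Sₙ) ⟩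
    (2 + w) * totalBonds² (suc w) + 5 * totalBonds (suc w) + sumMap (λ _ → 2) Sₙ
      ≡⟨ cong ((2 + w) * totalBonds² (suc w) + 5 * totalBonds (suc w) +_) (sumMap-const 2 Sₙ) ⟩
    (2 + w) * totalBonds² (suc w) + 5 * totalBonds (suc w) + length Sₙ * 2 ∎
    where
    open ≡-Reasoning
    Sₙ = S (suc w)
    B² C Σinsertions : List ℕ → ℕ
    B² p = bonds p * bonds p
    C = bondsMeeting (suc w)
    Σinsertions p = sumTo (λ j → B² (insertAt j (suc w) p)) (2 + w)

  private
    meeting-algebra : ∀ k F → (1 + k) * F * 2 ≡ 2 * (1 + k) * F
    meeting-algebra = solve-∀
    bonds-algebra : ∀ k F → (2 + k) * (2 * ((1 + k) * (1 + k)) * F) + (2 + k) * ((1 + k) * F) * 2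
                            ≡ 2 * ((2 + k) * (2 + k)) * ((1 + k) * F)
    bonds-algebra = solve-∀
    bonds²-algebra : ∀ k F →
      (4 * ((1 + k) * (1 + k)) + 2 * ((2 + k) * (2 + k))) * ((1 + k) * F)
        + 2 * ((4 * (k * k) + 2 * ((1 + k) * (1 + k))) * F) + 2 * (2 * (1 + k) * F)
      ≡ (3 + k) * ((4 * (k * k) + 2 * ((1 + k) * (1 + k))) * F) + 5 * (2 * ((1 + k) * (1 + k)) * F)
        + (2 + k) * ((1 + k) * F) * 2
    bonds²-algebra = solve-∀

  totalMeeting-closed : ∀ k → totalMeeting (2 + k) ≡ 2 * suc k * k !
  totalMeeting-closed k = trans (totalMeeting-suc k) (trans (cong (_* 2) (length-S (suc k))) (meeting-algebra k (k !)))

  totalBonds-closed : ∀ k → totalBonds (2 + k) ≡ 2 * (suc k * suc k) * k !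
  totalBonds-closed zero    = refl
  totalBonds-closed (suc k) = begin
    totalBonds (3 + k)                                                ≡⟨ totalBonds-suc (suc k) ⟩
    (2 + k) * totalBonds (2 + k) + length (S (2 + k)) * 2             ≡⟨ cong₂ (λ s t → (2 + k) * s + t * 2) (totalBonds-closed k) (length-S (2 + k)) ⟩
    (2 + k) * (2 * (suc k * suc k) * k !) + (2 + k) ! * 2             ≡⟨ bonds-algebra k (k !) ⟩
    2 * ((2 + k) * (2 + k)) * (suc k) !                               ∎
    where open ≡-Reasoning

  totalBonds²-closed : ∀ k → totalBonds² (2 + k) ≡ (4 * (k * k) + 2 * (suc k * suc k)) * k !
  totalBonds²-closed zero    = refl
  totalBonds²-closed (suc k) = +-cancelʳ-≡ (2 * T′ + 2 * C′) _ _ (begin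
    totalBonds² (3 + k) + (2 * T′ + 2 * C′)                  ≡⟨ +-assoc (totalBonds² (3 + k)) _ _ ⟨
    totalBonds² (3 + k) + 2 * T′ + 2 * C′                    ≡⟨ totalBonds²-suc (suc k) ⟩
    (3 + k) * T′ + 5 * totalBonds (2 + k) + length (S (2 + k)) * 2
                                                             ≡⟨ cong₂ _+_ (cong₂ (λ s t → (3 + k) * s + 5 * t) T′≡T (totalBonds-closed k))
                                                                          (cong (_* 2) (length-S (2 + k))) ⟩
    (3 + k) * T + 5 * (2 * (suc k * suc k) * k !) + (2 + k) ! * 2
                                                             ≡⟨ bonds²-algebra k (k !) ⟨
    target + 2 * T + 2 * C                                   ≡⟨ +-assoc target _ _ ⟩
    target + (2 * T + 2 * C)                                 ≡⟨ cong₂ (λ s t → target + (2 * s + 2 * t)) T′≡T (totalMeeting-closed k) ⟨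
    target + (2 * T′ + 2 * C′)                               ∎)
    where
    open ≡-Reasoning
    T′ = totalBonds² (2 + k)
    C′ = totalMeeting (2 + k)
    T = (4 * (k * k) + 2 * (suc k * suc k)) * k !
    C = 2 * suc k * k !
    target = (4 * (suc k * suc k) + 2 * ((2 + k) * (2 + k))) * (suc k) !
    T′≡T : T′ ≡ T
    T′≡T = totalBonds²-closed k

  square-complement : ∀ {x y N} → x + y ≡ N → x * x + 2 * (N * y) ≡ N * N + y * y
  square-complement {x} {y} refl = complete-square x y

  sumMap-m : ∀ n → sumMap m (S (suc n)) + totalBonds (suc n) ≡ length (S (suc n)) * suc n
  sumMap-m n = begin
    sumMap m (S (suc n)) + totalBonds (suc n)   ≡⟨ sumMap-+ m bonds (S (suc n)) ⟨
    sumMap (λ p → m p + bonds p) (S (suc n))    ≡⟨ sumMap-cong (S (suc n)) (m+bonds ∘ ∈-S⁻) ⟩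
    sumMap (λ _ → suc n) (S (suc n))            ≡⟨ sumMap-const (suc n) (S (suc n)) ⟩
    length (S (suc n)) * suc n                  ∎
    where open ≡-Reasoning

  sumMap-m² : ∀ n → sumMap (λ p → m p * m p) (S (suc n)) + 2 * (suc n * totalBonds (suc n))
                    ≡ length (S (suc n)) * (suc n * suc n) + totalBonds² (suc n)
  sumMap-m² n = begin
    sumMap m² Sₙ + 2 * (suc n * sumMap bonds Sₙ)           ≡⟨ cong (sumMap m² Sₙ +_) (sumMap-*-* 2 (suc n) bonds Sₙ) ⟨
    sumMap m² Sₙ + sumMap 2nB Sₙ                          ≡⟨ sumMap-+ m² 2nB Sₙ ⟨
    sumMap (λ p → m² p + 2nB p) Sₙ                        ≡⟨ sumMap-cong Sₙ (λ {p} p∈ → square-complement {m p} {bonds p} (m+bonds {n} (∈-S⁻ p∈))) ⟩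
    sumMap (λ p → suc n * suc n + B² p) Sₙ                ≡⟨ sumMap-+ (λ _ → suc n * suc n) B² Sₙ ⟩
    sumMap (λ _ → suc n * suc n) Sₙ + totalBonds² (suc n) ≡⟨ cong (_+ totalBonds² (suc n)) (sumMap-const (suc n * suc n) Sₙ) ⟩
    length Sₙ * (suc n * suc n) + totalBonds² (suc n)     ∎
    where
    open ≡-Reasoning
    Sₙ = S (suc n)
    m² 2nB B² : List ℕ → ℕ
    m² p = m p * m p
    2nB p = 2 * (suc n * bonds p)
    B² p = bonds p * bonds p

  meanNumerator secondMomentNumerator : ℕ → ℕ
  meanNumerator k = k * k + 2 * k + 2
  secondMomentNumerator k = k * k * k * k + 3 * (k * k * k) + 8 * (k * k) + 4 * k + 2

  private
    m-algebra : ∀ k F → (1 + k) * F * (k * k + 2 * k + 2) + 2 * ((1 + k) * (1 + k)) * F ≡ (2 + k) * ((1 + k) * F) * (2 + k)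
    m-algebra = solve-∀
    m²-algebra : ∀ k F →
      F * (k * k * k * k + 3 * (k * k * k) + 8 * (k * k) + 4 * k + 2) + 2 * ((2 + k) * (2 * ((1 + k) * (1 + k)) * F))
      ≡ (2 + k) * ((1 + k) * F) * ((2 + k) * (2 + k)) + (4 * (k * k) + 2 * ((1 + k) * (1 + k))) * F
    m²-algebra = solve-∀

  sumMap-m-closed : ∀ k → sumMap m (S (2 + k)) ≡ (1 + k) * k ! * meanNumerator k
  sumMap-m-closed k = +-cancelʳ-≡ (totalBonds (2 + k)) _ _ (begin
    sumMap m (S (2 + k)) + totalBonds (2 + k)                  ≡⟨ sumMap-m (suc k) ⟩
    length (S (2 + k)) * (2 + k)                               ≡⟨ cong (_* (2 + k)) (length-S (2 + k)) ⟩
    (2 + k) ! * (2 + k)                                        ≡⟨ m-algebra k (k !) ⟨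
    closed + 2 * (suc k * suc k) * k !                         ≡⟨ cong (closed +_) (totalBonds-closed k) ⟨
    closed + totalBonds (2 + k)                                ∎)
    where
    open ≡-Reasoning
    closed = (1 + k) * k ! * meanNumerator k

  sumMap-m²-closed : ∀ k → sumMap (λ p → m p * m p) (S (2 + k)) ≡ k ! * secondMomentNumerator k
  sumMap-m²-closed k = +-cancelʳ-≡ (2 * ((2 + k) * totalBonds (2 + k))) _ _ (begin
    sumMap (λ p → m p * m p) (S (2 + k)) + 2 * ((2 + k) * totalBonds (2 + k))
      ≡⟨ sumMap-m² (suc k) ⟩
    length (S (2 + k)) * ((2 + k) * (2 + k)) + totalBonds² (2 + k)
      ≡⟨ cong₂ (λ s t → s * ((2 + k) * (2 + k)) + t) (length-S (2 + k)) (totalBonds²-closed k) ⟩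
    (2 + k) ! * ((2 + k) * (2 + k)) + (4 * (k * k) + 2 * (suc k * suc k)) * k !
      ≡⟨ m²-algebra k (k !) ⟨
    closed + 2 * ((2 + k) * (2 * (suc k * suc k) * k !))
      ≡⟨ cong (λ t → closed + 2 * ((2 + k) * t)) (totalBonds-closed k) ⟨
    closed + 2 * ((2 + k) * totalBonds (2 + k)) ∎)
    where
    open ≡-Reasoning
    closed = k ! * secondMomentNumerator k

  mean-cross : ∀ k → sumMap m (S (2 + k)) * (2 + k) ≡ meanNumerator k * (2 + k) !
  mean-cross k = trans (cong (_* (2 + k)) (sumMap-m-closed k)) (algebra k (k !))
    where
    algebra : ∀ k F → (1 + k) * F * (k * k + 2 * k + 2) * (2 + k) ≡ (k * k + 2 * k + 2) * ((2 + k) * ((1 + k) * F))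
    algebra = solve-∀

  second-moment-cross : ∀ k → sumMap (λ p → m p * m p) (S (2 + k)) * ((2 + k) * (1 + k))
                              ≡ secondMomentNumerator k * (2 + k) !
  second-moment-cross k = trans (cong (_* ((2 + k) * (1 + k))) (sumMap-m²-closed k)) (algebra k (k !))
    where
    algebra : ∀ k F → F * (k * k * k * k + 3 * (k * k * k) + 8 * (k * k) + 4 * k + 2) * ((2 + k) * (1 + k)) ≡ (k * k * k * k + 3 * (k * k * k) + 8 * (k * k) + 4 * k + 2) * ((2 + k) * ((1 + k) * F))
    algebra = solve-∀

  mean-identity : ∀ k → (meanNumerator k * (2 + k) + 2 * (1 + k) * (2 + k)) * 1 ≡ (2 + k) * ((2 + k) * (2 + k))
  mean-identity = identity
    where
    identity : ∀ k → ((k * k + 2 * k + 2) * (2 + k) + 2 * (1 + k) * (2 + k)) * 1 ≡ (2 + k) * ((2 + k) * (2 + k))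
    identity = solve-∀

  variance-identity : ∀ k →
    (secondMomentNumerator k * ((2 + k) * (2 + k)) + 4 * (1 + k) ^ 2 * ((2 + k) * (1 + k)))
      * (((2 + k) * (1 + k) * (2 + k)) * ((2 + k) * (2 + k)))
    ≡ ((4 * k ^ 2 * (2 + k) + 2 * (1 + k) * ((2 + k) * (1 + k))) * ((2 + k) * (2 + k))
        + meanNumerator k * meanNumerator k * ((2 + k) * (1 + k) * (2 + k)))
      * (((2 + k) * (1 + k)) * ((2 + k) * (2 + k)))
  variance-identity = identity
    where
    -- x ^ 2 unfolds to x * (x * 1); the ring solver does not accept _^_.
    identity : ∀ k →
      ((k * k * k * k + 3 * (k * k * k) + 8 * (k * k) + 4 * k + 2) * ((2 + k) * (2 + k)) + 4 * ((1 + k) * ((1 + k) * 1)) * ((2 + k) * (1 + k)))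
        * (((2 + k) * (1 + k) * (2 + k)) * ((2 + k) * (2 + k)))
      ≡ ((4 * (k * (k * 1)) * (2 + k) + 2 * (1 + k) * ((2 + k) * (1 + k))) * ((2 + k) * (2 + k))
          + (k * k + 2 * k + 2) * (k * k + 2 * k + 2) * ((2 + k) * (1 + k) * (2 + k)))
        * (((2 + k) * (1 + k)) * ((2 + k) * (2 + k)))
    identity = solve-∀

open Counting

open import Data.Integer using (+_)
import Data.Integer as ℤ
import Data.Integer.Properties as ℤ
open import Data.Rational using (_/_; _+_; _-_; _*_; toℚᵘ; fromℚᵘ)
open import Data.Rational.Properties using (toℚᵘ-injective; toℚᵘ-fromℚᵘ; fromℚᵘ-cong; toℚᵘ-homo-+; toℚᵘ-homo-*)
import Data.Rational.Unnormalised as ℚᵘ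
import Data.Rational.Unnormalised.Properties as ℚᵘ
open import Data.Rational.Solver using (module +-*-Solver)
open +-*-Solver using (solve; _:=_; _:+_; _:-_)

/-cross : ∀ a b c d .{{_ : NonZero b}} .{{_ : NonZero d}} → a ℕ.* d ≡ c ℕ.* b → (+ a) / b ≡ (+ c) / d
/-cross a (suc b) c (suc d) ad≡cb = fromℚᵘ-cong {ℚᵘ.mkℚᵘ (+ a) b} {ℚᵘ.mkℚᵘ (+ c) d}
  (ℚᵘ.*≡* (trans (sym (ℤ.pos-* a (suc d))) (trans (cong +_ ad≡cb) (ℤ.pos-* c (suc b)))))

/-+-/ : ∀ a b c d .{{_ : NonZero b}} .{{_ : NonZero d}} →
        (+ a) / b + (+ c) / d ≡ ((+ (a ℕ.* d ℕ.+ c ℕ.* b)) / (b ℕ.* d)) {{m*n≢0 b d}}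
/-+-/ a (suc b) c (suc d) = toℚᵘ-injective (begin
  toℚᵘ (fromℚᵘ x + fromℚᵘ y)                ≈⟨ toℚᵘ-homo-+ (fromℚᵘ x) (fromℚᵘ y) ⟩
  toℚᵘ (fromℚᵘ x) ℚᵘ.+ toℚᵘ (fromℚᵘ y)      ≈⟨ ℚᵘ.+-cong (toℚᵘ-fromℚᵘ x) (toℚᵘ-fromℚᵘ y) ⟩
  x ℚᵘ.+ y                                  ≡⟨ cong (λ t → ℚᵘ.mkℚᵘ t (d ℕ.+ b ℕ.* suc d)) numerator ⟩
  z                                         ≈⟨ toℚᵘ-fromℚᵘ z ⟨
  toℚᵘ (fromℚᵘ z)                           ∎)
  where
  open ℚᵘ.≃-Reasoning
  x = ℚᵘ.mkℚᵘ (+ a) b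
  y = ℚᵘ.mkℚᵘ (+ c) d
  z = ℚᵘ.mkℚᵘ (+ (a ℕ.* suc d ℕ.+ c ℕ.* suc b)) (d ℕ.+ b ℕ.* suc d)
  numerator : + a ℤ.* + suc d ℤ.+ + c ℤ.* + suc b ≡ + (a ℕ.* suc d ℕ.+ c ℕ.* suc b)
  numerator = trans (cong₂ ℤ._+_ (sym (ℤ.pos-* a (suc d))) (sym (ℤ.pos-* c (suc b))))
                    (sym (ℤ.pos-+ (a ℕ.* suc d) (c ℕ.* suc b)))

/-*-/ : ∀ a b c d .{{_ : NonZero b}} .{{_ : NonZero d}} →
        ((+ a) / b) * ((+ c) / d) ≡ ((+ (a ℕ.* c)) / (b ℕ.* d)) {{m*n≢0 b d}}
/-*-/ a (suc b) c (suc d) = toℚᵘ-injective (begin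
  toℚᵘ (fromℚᵘ x * fromℚᵘ y)                ≈⟨ toℚᵘ-homo-* (fromℚᵘ x) (fromℚᵘ y) ⟩
  toℚᵘ (fromℚᵘ x) ℚᵘ.* toℚᵘ (fromℚᵘ y)      ≈⟨ ℚᵘ.*-cong (toℚᵘ-fromℚᵘ x) (toℚᵘ-fromℚᵘ y) ⟩
  x ℚᵘ.* y                                  ≡⟨ cong (λ t → ℚᵘ.mkℚᵘ t (d ℕ.+ b ℕ.* suc d)) (sym (ℤ.pos-* a c)) ⟩
  z                                         ≈⟨ toℚᵘ-fromℚᵘ z ⟨
  toℚᵘ (fromℚᵘ z)                           ∎)
  where
  open ℚᵘ.≃-Reasoning
  x = ℚᵘ.mkℚᵘ (+ a) b
  y = ℚᵘ.mkℚᵘ (+ c) d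
  z = ℚᵘ.mkℚᵘ (+ (a ℕ.* c)) (d ℕ.+ b ℕ.* suc d)

x+z≡y⇒x≡y-z : ∀ x y z → x + z ≡ y → x ≡ y - z
x+z≡y⇒x≡y-z x y z x+z≡y = trans (solve 2 (λ x z → x := (x :+ z) :- z) refl x z) (cong (_- z) x+z≡y)

p+t≡r+q⇒p-q≡r-t : ∀ p q r t → p + t ≡ r + q → p - q ≡ r - t
p+t≡r+q⇒p-q≡r-t p q r t p+t≡r+q = trans (solve 3 (λ p q t → p :- q := (p :+ t) :- t :- q) refl p q t)
  (trans (cong (λ z → z - t - q) p+t≡r+q) (solve 3 (λ r q t → (r :+ q) :- t :- q := r :- t) refl r q t))

mean-closed : ∀ k → E (2 ℕ.+ k) ≡ (+ meanNumerator k) / (2 ℕ.+ k)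
mean-closed k = /-cross (sumMap m (S (2 ℕ.+ k))) ((2 ℕ.+ k) !) (meanNumerator k) (2 ℕ.+ k) {{(2 ℕ.+ k) !≢0}} (mean-cross k)

second-moment-closed : ∀ k → ((+ sumMap (λ p → m p ℕ.* m p) (S (2 ℕ.+ k))) / ((2 ℕ.+ k) !)) {{(2 ℕ.+ k) !≢0}}
                             ≡ (+ secondMomentNumerator k) / ((2 ℕ.+ k) ℕ.* (1 ℕ.+ k))
second-moment-closed k =
  /-cross (sumMap (λ p → m p ℕ.* m p) (S (2 ℕ.+ k))) ((2 ℕ.+ k) !) (secondMomentNumerator k) ((2 ℕ.+ k) ℕ.* (1 ℕ.+ k))
          {{(2 ℕ.+ k) !≢0}} (second-moment-cross k)

E-value : ∀ k → E (2 ℕ.+ k) ≡ frac (2 ℕ.+ k) 1 - frac (2 ℕ.* suc k) (2 ℕ.+ k)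
E-value k = x+z≡y⇒x≡y-z (E n) ((+ n) / 1) ((+ b) / n) (begin
  E n + (+ b) / n                      ≡⟨ cong (_+ (+ b) / n) (mean-closed k) ⟩
  (+ a) / n + (+ b) / n                ≡⟨ /-+-/ a n b n ⟩
  (+ (a ℕ.* n ℕ.+ b ℕ.* n)) / (n ℕ.* n) ≡⟨ /-cross (a ℕ.* n ℕ.+ b ℕ.* n) (n ℕ.* n) n 1 (mean-identity k) ⟩
  (+ n) / 1                            ∎)
  where
  open ≡-Reasoning
  n = 2 ℕ.+ k
  a = meanNumerator k
  b = 2 ℕ.* suc k

Var-value : ∀ k → let n = 2 ℕ.+ k in
  Var n ≡ frac (4 ℕ.* k ^ 2) (n ℕ.* suc k) + frac (2 ℕ.* suc k) n - frac (4 ℕ.* suc k ^ 2) (n ℕ.* n)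
Var-value k = begin
  Var n                    ≡⟨ cong₂ (λ P e → P - e * e) (second-moment-closed k) (mean-closed k) ⟩
  (+ s) / d₁ - μ * μ       ≡⟨ p+t≡r+q⇒p-q≡r-t ((+ s) / d₁) (μ * μ) (f₁ + f₂) f₃ (begin
    (+ s) / d₁ + (+ c) / d₃       ≡⟨ /-+-/ s d₁ c d₃ ⟩
    (+ (s ℕ.* d₃ ℕ.+ c ℕ.* d₁)) / (d₁ ℕ.* d₃)
                                  ≡⟨ /-cross (s ℕ.* d₃ ℕ.+ c ℕ.* d₁) (d₁ ℕ.* d₃) (u ℕ.* d₃ ℕ.+ a ℕ.* a ℕ.* d₂) (d₂ ℕ.* d₃) (variance-identity k) ⟩
    (+ (u ℕ.* d₃ ℕ.+ a ℕ.* a ℕ.* d₂)) / (d₂ ℕ.* d₃)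
                                  ≡⟨ /-+-/ u d₂ (a ℕ.* a) d₃ ⟨
    (+ u) / d₂ + (+ (a ℕ.* a)) / d₃
                                  ≡⟨ cong₂ _+_ (/-+-/ l d₁ b n) (/-*-/ a n a n) ⟨
    f₁ + f₂ + μ * μ               ∎) ⟩
  f₁ + f₂ - f₃             ∎
  where
  open ≡-Reasoning
  n = 2 ℕ.+ k
  d₁ = n ℕ.* suc k
  d₂ = d₁ ℕ.* n
  d₃ = n ℕ.* n
  a = meanNumerator k
  s = secondMomentNumerator k
  b = 2 ℕ.* suc k
  c = 4 ℕ.* suc k ^ 2
  l = 4 ℕ.* k ^ 2
  u = l ℕ.* n ℕ.+ b ℕ.* d₁
  μ = (+ a) / n
  f₁ = frac l d₁
  f₂ = frac b n
  f₃ = frac c d₃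

theorem3 : (n : ℕ) → 2 ≤ n →
    (E n ≡ frac n 1 - frac (2 ℕ.* (n ∸ 1)) n)
    × (Var n ≡ frac (4 ℕ.* (n ∸ 2) ^ 2) (n ℕ.* (n ∸ 1)) + frac (2 ℕ.* (n ∸ 1)) n - frac (4 ℕ.* (n ∸ 1) ^ 2) (n ℕ.* n))
theorem3 (suc (suc k)) (s≤s (s≤s z≤n)) = E-value k , Var-value k
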